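{- Let $S$ be a quasi-tree of a map $\mathcal M$ and let $e,f$ be distinct edges of $\mathcal M$ that are adjacent in (the circle graph of) $\widetilde\Lambda(\mathcal M,S)$. Then $S'=S\triangle\{e,f\}$ is a quasi-tree of $\mathcal M$, and the vertex-colored circle graph of $\widetilde\Lambda(\mathcal M,S')$ is obtained from the pivoted graph $\widetilde\Lambda(\mathcal M,S)\wedge ef$ by exchanging the colors of $e$ and $f$ (all other colors unchanged). Conversely, if $S'=S\triangle\{e,f\}$ is a quasi-tree of $\mathcal M$ for distinct edges $e,f$, then $e$ and $f$ are adjacent in $\widetilde\Lambda(\mathcal M,S)$.
   Context: A map is a triple $\mathcal M=(B,\sigma,\alpha)$ with $B$ a finite set (of flags), $\sigma,\alpha\in\mathrm{Sym}(B)$, $\alpha$ a fixed-point-free involution, $\langle\sigma,\alpha\rangle$ transitive on $B$; permutations compose as functions. Edges are cycles of $\alpha$; $\underline b=\{b,\alpha(b)\}$. The tour of a set $F$ of edges is $\tau$ with $\tau(b)=\sigma\alpha(b)$ if $\underline b\in F$, $\tau(b)=\sigma(b)$ otherwise; a quasi-tree is a set of edges whose tour is a single cycle on $B$. For a quasi-tree $S$ with tour $\tau$, $\widetilde\Lambda(\mathcal M,S)$ is the chord diagram obtained by placing the flags on a circle in the cyclic order of $\tau$ and joining by a chord the two flags of each edge; chords of edges in $S$ get color 1, the others color 2. Its circle graph has the edges of $\mathcal M$ as vertices (with these colors), two being adjacent iff their chords cross (their endpoints alternate around the circle). For a graph $G$ and vertex $v$, the local complementation $G\ast v$ replaces the subgraph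 induced on the neighborhood of $v$ by its complement; for an edge $uv$, the pivot is $G\wedge uv=G\ast u\ast v\ast u$. -}

module Defs where

open import Data.Nat using (ℕ; zero; suc; _<_)
open import Data.Fin using (Fin; _≟_)
open import Data.Fin.Permutation using (Permutation′; _⟨$⟩ʳ_; _⟨$⟩ˡ_)
open import Data.Bool using (Bool; true; false; if_then_else_; _xor_; _∨_)
open import Data.List using (List; []; _∷_)
open import Data.Product using (Σ; ∃; _×_; _,_)
open import Data.Sum using (_⊎_)
open import Function.Bundles using (_⇔_)
open import Relation.Binary.PropositionalEquality using (_≡_; _≢_)
open import Relation.Nullary using (¬_)
open import Relation.Nullary.Decidable using (⌊_⌋)

iter : {A : Set} → ℕ → (A → A) → A → A
iter zero    g a = a
iter (suc k) g a = g (iter k g a)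

-- generators of the monodromy group <σ, α> (α is an involution, so α⁻¹ = α)
data Gen : Set where
  gσ gσ⁻¹ gα : Gen

act : {n : ℕ} → Permutation′ n → Permutation′ n → List Gen → Fin n → Fin n
act σ α []          b = b
act σ α (gσ   ∷ w) b = σ ⟨$⟩ʳ act σ α w b
act σ α (gσ⁻¹ ∷ w) b = σ ⟨$⟩ˡ act σ α w b
act σ α (gα   ∷ w) b = α ⟨$⟩ʳ act σ α w b

-- A map with flag set B = Fin n.
record Map (n : ℕ) : Set where
  field
    σ α        : Permutation′ n
    α-invol    : ∀ b → α ⟨$⟩ʳ (α ⟨$⟩ʳ b) ≡ b
    α-fpf      : ∀ b → α ⟨$⟩ʳ b ≢ b
    transitive : ∀ b c → ∃ λ (w : List Gen) → act σ α w b ≡ c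

-- Vertex-colored graphs on the flags (a vertex = an edge of the map, i.e. a
-- flag up to α). Colour true = colour 1, false = colour 2.
record CGraph (n : ℕ) : Set₁ where
  field
    adj : Fin n → Fin n → Set
    col : Fin n → Bool

module _ {n : ℕ} (M : Map n) where
  open Map M

  σ' α' : Fin n → Fin n
  σ' b = σ ⟨$⟩ʳ b
  α' b = α ⟨$⟩ʳ b

  -- a set of edges = α-invariant subset of flags
  IsEdgeSet : (Fin n → Bool) → Set
  IsEdgeSet F = ∀ b → F (α' b) ≡ F b

  tour : (Fin n → Bool) → Fin n → Fin n
  tour F b = if F b then σ' (α' b) else σ' b

  IsSingleCycle : (Fin n → Fin n) → Set
  IsSingleCycle τ = ∀ b c → ∃ λ k → iter k τ b ≡ c

  IsQuasiTree : (Fin n → Bool) → Set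
  IsQuasiTree F = IsEdgeSet F × IsSingleCycle (tour F)

  DistinctEdges : Fin n → Fin n → Set
  DistinctEdges x y = (y ≢ x) × (y ≢ α' x)

  inEdge : Fin n → Fin n → Bool
  inEdge e b = ⌊ b ≟ e ⌋ ∨ ⌊ b ≟ α' e ⌋

  symDiff : (Fin n → Bool) → Fin n → Fin n → Fin n → Bool
  symDiff S e f b = S b xor (inEdge e b ∨ inEdge f b)

  -- x lies strictly between a and y when walking along the cycle τ from a
  -- (meaningful when τ is a single cycle on all n flags)
  Between : (Fin n → Fin n) → Fin n → Fin n → Fin n → Set
  Between τ a x y = ∃ λ i → ∃ λ j →
    (0 < i) × (i < j) × (j < n) × (iter i τ a ≡ x) × (iter j τ a ≡ y)

  -- chords {a, α a} and {c, α c} cross in the circular order of τ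
  Cross : (Fin n → Fin n) → Fin n → Fin n → Set
  Cross τ a c =
      (Between τ a c (α' a) × ¬ Between τ a (α' c) (α' a))
    ⊎ (¬ Between τ a c (α' a) × Between τ a (α' c) (α' a))

  Λ̃ : (Fin n → Bool) → CGraph n
  Λ̃ S = record { adj = Cross (tour S) ; col = S }

  _∗_ : CGraph n → Fin n → CGraph n
  G ∗ v = record
    { adj = λ x y →
        (DistinctEdges x y × adj v x × adj v y × ¬ adj x y)
      ⊎ (¬ (DistinctEdges x y × adj v x × adj v y) × adj x y)
    ; col = col }
    where open CGraph G

  pivot : CGraph n → Fin n → Fin n → CGraph n
  pivot G u v = ((G ∗ u) ∗ v) ∗ u

  switchColours : CGraph n → Fin n → Fin n → CGraph n
  switchColours G e f = record
    { adj = CGraph.adj G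
    ; col = λ b → CGraph.col G b xor (inEdge e b ∨ inEdge f b) }

_≅_ : {n : ℕ} → CGraph n → CGraph n → Set
G ≅ H = (∀ x y → CGraph.adj G x y ⇔ CGraph.adj H x y)
      × (∀ x → CGraph.col G x ≡ CGraph.col H x)

module Submission where

-- Rank the flags 0, …, n-1 along the tour τ of S starting at e, and let α e have rank j. The
-- chords of e and f cross iff one end c of f has rank i < j and the other, c′ = α c, rank k > j.
-- The tour of S △ {e, f} agrees with τ except at e, α e, c, c′, where it continues from their
-- α-partners instead, so it runs through the segments (0,i], (i,j], (j,k] of τ in the order
-- (j,k], (i,j], (0,i]. This exchange of segments is a bijection of ranks, hence the new tour is
-- again a single cycle; it changes the cyclic order of three flags by an amount depending only on
-- their segments, so comparing the new crossings with the pivot formula is a finite check. If the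
-- chords do not cross, both ends of f lie on one side of α e, and one of the two arcs between the
-- ends of e is closed under the new tour, which is therefore not a single cycle.

open import Defs
open import Algebra.Bundles using (CommutativeRing)
open import Data.Bool using (Bool; true; false; not; T; _∧_; _∨_; _xor_; if_then_else_)
open import Data.Bool.Properties using (∨-comm; ∨-zeroʳ; xor-∧-commutativeRing; xor-assoc; xor-comm; xor-identityʳ; xor-same)
open import Algebra.Properties.CommutativeSemigroup
  (CommutativeRing.+-commutativeSemigroup xor-∧-commutativeRing) using (interchange)
open import Data.Empty using (⊥-elim)
open import Data.Fin using (Fin; toℕ; fromℕ<) renaming (_≟_ to _≟ᶠ_)
import Data.Fin.Properties as Fin
open import Data.Fin.Permutation using (_⟨$⟩ˡ_; inverseˡ)
open import Data.Nat
open import Data.Nat.Properties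
open import Data.Product using (∃; _×_; _,_; proj₁; proj₂)
open import Data.Sum using (_⊎_; inj₁; inj₂; [_,_])
open import Data.Unit using (tt)
open import Function.Base using (_∘_)
open import Function.Bundles using (_⇔_; mk⇔)
open import Relation.Binary.Definitions using (tri<; tri≈; tri>)
open import Relation.Binary.PropositionalEquality hiding ([_])
open import Relation.Nullary
open import Relation.Nullary.Decidable using (¬?; _×-dec_)

<ᵇ-true : ∀ {m n} → m < n → (m <ᵇ n) ≡ true
<ᵇ-true {m} {n} m<n with m <ᵇ n | <⇒<ᵇ m<n
... | true | _ = refl

<ᵇ-false : ∀ {m n} → n ≤ m → (m <ᵇ n) ≡ false
<ᵇ-false {m} {n} n≤m with m <ᵇ n | <ᵇ⇒< m n
... | false | _   = refl
... | true  | m<n = contradiction (m<n tt) (≤⇒≯ n≤m)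

n≢0⇒n≡ᵇ0≡false : ∀ {n} → n ≢ 0 → (n ≡ᵇ 0) ≡ false
n≢0⇒n≡ᵇ0≡false {zero}  n≢0 = contradiction refl n≢0
n≢0⇒n≡ᵇ0≡false {suc _} _   = refl

<ᵇ-irrefl : ∀ m → (m <ᵇ m) ≡ false
<ᵇ-irrefl m = <ᵇ-false (≤-refl {m})

<ᵇ-cong : ∀ {a b c d} → (a < b → c < d) → (c < d → a < b) → (a <ᵇ b) ≡ (c <ᵇ d)
<ᵇ-cong {a} {b} {c} {d} to from =
  det (<ᵇ-reflects-< a b) (fromEquivalence (from ∘ <ᵇ⇒< c d) (<⇒<ᵇ ∘ to))

<ᵇ-transport : ∀ (g : ℕ → ℕ) {p q} → (p < q → g p < g q) → (q ≤ p → g q ≤ g p) → (g p <ᵇ g q) ≡ (p <ᵇ q)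
<ᵇ-transport g inc mono = <ᵇ-cong (λ gp<gq → ≰⇒> (λ q≤p → <⇒≱ gp<gq (mono q≤p))) inc

<ᵇ-via-monotone : ∀ (g : ℕ → ℕ) → (∀ {p q} → p ≤ q → g p ≤ g q) → ∀ {p q} → g p ≢ g q →
                  (g p <ᵇ g q) ≡ (p <ᵇ q)
<ᵇ-via-monotone g mono gp≢gq = <ᵇ-transport g (λ p<q → ≤∧≢⇒< (mono (<⇒≤ p<q)) gp≢gq) mono

<ᵇ-false⇒≥ : ∀ {m n} → (m <ᵇ n) ≡ false → n ≤ m
<ᵇ-false⇒≥ {m} {n} e = ≮⇒≥ λ m<n → subst T e (<⇒<ᵇ m<n)

xor-cancelˡ : ∀ a b → a xor (a xor b) ≡ b
xor-cancelˡ a b = trans (sym (xor-assoc a a b)) (cong (_xor b) (xor-same a))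

xor-cancel-common : ∀ a b g → (a xor g) xor (b xor g) ≡ a xor b
xor-cancel-common a b g = trans (interchange a g b g) (trans (cong ((a xor b) xor_) (xor-same g)) (xor-identityʳ _))

reflects-true : ∀ {A : Set} {b} → Reflects A b → A → b ≡ true
reflects-true (ofʸ _)  _ = refl
reflects-true (ofⁿ ¬a) a = contradiction a ¬a

reflects-false : ∀ {A : Set} {b} → Reflects A b → ¬ A → b ≡ false
reflects-false (ofʸ a) ¬a = contradiction a ¬a
reflects-false (ofⁿ _) _  = refl

reflects-sound : ∀ {A : Set} {b} → Reflects A b → b ≡ true → A
reflects-sound (ofʸ a) _ = a

reflects-refute : ∀ {A : Set} {b} → Reflects A b → b ≡ false → ¬ A
reflects-refute (ofⁿ ¬a) _ = ¬a

reflects-⇔ : ∀ {A B : Set} {b} → Reflects A b → Reflects B b → A ⇔ B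
reflects-⇔ (ofʸ a)  (ofʸ b)  = mk⇔ (λ _ → b) (λ _ → a)
reflects-⇔ (ofⁿ ¬a) (ofⁿ ¬b) = mk⇔ (λ a → contradiction a ¬a) (λ b → contradiction b ¬b)

xor-reflects : ∀ {A B : Set} {a b} → Reflects A a → Reflects B b →
               Reflects ((A × ¬ B) ⊎ (¬ A × B)) (a xor b)
xor-reflects (ofʸ a) (ofʸ b) = ofⁿ λ { (inj₁ (_ , ¬b)) → ¬b b ; (inj₂ (¬a , _)) → ¬a a }
xor-reflects (ofʸ a) (ofⁿ ¬b) = ofʸ (inj₁ (a , ¬b))
xor-reflects (ofⁿ ¬a) (ofʸ b) = ofʸ (inj₂ (¬a , b))
xor-reflects (ofⁿ ¬a) (ofⁿ ¬b) = ofⁿ λ { (inj₁ (a , _)) → ¬a a ; (inj₂ (_ , b)) → ¬b b }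

-- r′ is r + m reduced modulo n (for r, m, r′ < n at most one wrap-around occurs)
data AddMod (n r m r′ : ℕ) : Set where
  noWrap : m + r ≡ r′     → AddMod n r m r′
  wrap   : m + r ≡ r′ + n → AddMod n r m r′

module _ {n : ℕ} where

  AddMod-zero : ∀ r → AddMod n r 0 r
  AddMod-zero r = noWrap refl

  AddMod-suc : ∀ {r m r′ r″} → r < n → suc m < n →
               AddMod n r m r′ → AddMod n r′ 1 r″ → AddMod n r (suc m) r″
  AddMod-suc _   _   (noWrap e₁) (noWrap e₂) = noWrap (trans (cong suc e₁) e₂)
  AddMod-suc _   _   (noWrap e₁) (wrap e₂)   = wrap (trans (cong suc e₁) e₂)
  AddMod-suc _   _   (wrap e₁)   (noWrap e₂) = wrap (trans (cong suc e₁) (cong (_+ n) e₂))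
  AddMod-suc {r} {m} {r″ = r″} r<n m<n (wrap e₁) (wrap e₂) =
    contradiction (+-mono-< m<n r<n) (≤⇒≯ (subst (n + n ≤_) (sym (trans (cong suc e₁) (cong (_+ n) e₂)))
                                                 (+-monoˡ-≤ n (m≤n+m n r″))))

  AddMod-functional : ∀ {r m r′ r″} → r′ < n → r″ < n →
                      AddMod n r m r′ → AddMod n r m r″ → r′ ≡ r″
  AddMod-functional _    _    (noWrap e₁) (noWrap e₂) = trans (sym e₁) e₂
  AddMod-functional {r″ = r″} r′<n _ (noWrap e₁) (wrap e₂) =
    contradiction r′<n (≤⇒≯ (subst (n ≤_) (trans (sym e₂) e₁) (m≤n+m n r″)))
  AddMod-functional {r′ = r′} _ r″<n (wrap e₁) (noWrap e₂) =
    contradiction r″<n (≤⇒≯ (subst (n ≤_) (trans (sym e₁) e₂) (m≤n+m n r′)))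
  AddMod-functional _    _    (wrap e₁)   (wrap e₂)   = +-cancelʳ-≡ n _ _ (trans (sym e₁) e₂)

  private
    wrapped-offset-≥ : ∀ {r m m′ r′} → m + r ≡ r′ → m′ + r ≡ r′ + n → n ≤ m′
    wrapped-offset-≥ {r} {m} e₁ e₂ =
      +-cancelʳ-≤ r _ _ (subst (n + r ≤_) (trans (cong (_+ n) e₁) (sym e₂))
                                       (≤-trans (≤-reflexive (+-comm n r)) (+-monoˡ-≤ n (m≤n+m r m))))

  AddMod-offset-unique : ∀ {r m m′ r′} → m < n → m′ < n →
                         AddMod n r m r′ → AddMod n r m′ r′ → m ≡ m′
  AddMod-offset-unique {r} _ _ (noWrap e₁) (noWrap e₂) = +-cancelʳ-≡ r _ _ (trans e₁ (sym e₂))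
  AddMod-offset-unique {r} _ _ (wrap e₁)   (wrap e₂)   = +-cancelʳ-≡ r _ _ (trans e₁ (sym e₂))
  AddMod-offset-unique _ m′<n (noWrap e₁) (wrap e₂) = contradiction m′<n (≤⇒≯ (wrapped-offset-≥ e₁ e₂))
  AddMod-offset-unique m<n _  (wrap e₁) (noWrap e₂) = contradiction m<n (≤⇒≯ (wrapped-offset-≥ e₂ e₁))

  AddMod-exists : ∀ {r r′} → r < n → r′ < n → ∃ λ m → m < n × AddMod n r m r′
  AddMod-exists {r} {r′} r<n r′<n with r ≤? r′
  ... | yes r≤r′ = r′ ∸ r , ≤-<-trans (m∸n≤m r′ r) r′<n , noWrap (m∸n+n≡m r≤r′)
  ... | no  r≰r′ = (r′ + n) ∸ r , offset<n , wrap sum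
    where
    sum : (r′ + n) ∸ r + r ≡ r′ + n
    sum = m∸n+n≡m (≤-trans (<⇒≤ r<n) (m≤n+m n r′))
    offset<n : (r′ + n) ∸ r < n
    offset<n = +-cancelʳ-< r _ _ (subst₂ _<_ (sym sum) (+-comm r n) (+-monoˡ-< n (≰⇒> r≰r′)))

  wrap-to-0 : ∀ {r r′} → r < n → suc r ≡ r′ + n → r′ ≡ 0
  wrap-to-0 {r′ = r′} r<n e = n≤0⇒n≡0 (+-cancelʳ-≤ n r′ 0 (subst (_≤ n) e r<n))

  AddMod-one : ∀ {r r′} → r < n → AddMod n r 1 r′ → r′ ≡ suc r ⊎ (r′ ≡ 0 × suc r ≡ n)
  AddMod-one _   (noWrap e) = inj₁ (sym e)
  AddMod-one r<n (wrap e)   = inj₂ (wrap-to-0 r<n e , trans e (cong (_+ n) (wrap-to-0 r<n e)))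

-- b lies strictly between a and c in the cyclic order, when a, b, c are distinct
cyclic : ℕ → ℕ → ℕ → Bool
cyclic a b c = ((b <ᵇ a) xor (b <ᵇ c)) xor (c <ᵇ a)

cyclic-by : ∀ a b c {x y z} → (b <ᵇ a) ≡ x → (b <ᵇ c) ≡ y → (c <ᵇ a) ≡ z → cyclic a b c ≡ (x xor y) xor z
cyclic-by _ _ _ refl refl refl = refl

module _ {n : ℕ} where

  private
    noWrap⇒≤ : ∀ {r m r′} → m + r ≡ r′ → r ≤ r′
    noWrap⇒≤ {r} {m} e = subst (r ≤_) e (m≤n+m r m)

    wrap⇒< : ∀ {r m r′} → m < n → m + r ≡ r′ + n → r′ < r
    wrap⇒< {r} {m} {r′} m<n e = +-cancelʳ-< n r′ r (subst₂ _<_ e (+-comm n r) (+-monoˡ-< r m<n))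

    true-xor-true : ∀ x → (true xor x) xor true ≡ x
    true-xor-true true  = refl
    true-xor-true false = refl


  AddMod-<ᵇ-cyclic : ∀ {r d d′ r₁ r₂} → r₁ < n → r₂ < n → d < n → d′ < n →
                     AddMod n r d r₁ → AddMod n r d′ r₂ → (d <ᵇ d′) ≡ cyclic r r₁ r₂
  AddMod-<ᵇ-cyclic {r} {d} {d′} {r₁} {r₂} _ _ _ _ (noWrap e₁) (noWrap e₂) =
    trans (<ᵇ-cong (λ d<d′ → subst₂ _<_ e₁ e₂ (+-monoˡ-< r d<d′))
                   (λ r₁<r₂ → +-cancelʳ-< r _ _ (subst₂ _<_ (sym e₁) (sym e₂) r₁<r₂)))
          (sym (trans (cyclic-by r r₁ r₂ (<ᵇ-false (noWrap⇒≤ {r} {d} e₁)) refl (<ᵇ-false (noWrap⇒≤ {r} {d′} e₂)))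
                      (xor-identityʳ _)))
  AddMod-<ᵇ-cyclic {r} {d} {d′} {r₁} {r₂} r₁<n _ _ d′<n (noWrap e₁) (wrap e₂) =
    trans (<ᵇ-true (+-cancelʳ-< r _ _ (subst₂ _<_ (sym e₁) (sym e₂) (<-≤-trans r₁<n (m≤n+m n r₂)))))
          (sym (cyclic-by r r₁ r₂ (<ᵇ-false (noWrap⇒≤ {r} {d} e₁))
                          (<ᵇ-false (≤-trans (<⇒≤ (wrap⇒< {r} {d′} d′<n e₂)) (noWrap⇒≤ {r} {d} e₁)))
                          (<ᵇ-true (wrap⇒< {r} {d′} d′<n e₂))))
  AddMod-<ᵇ-cyclic {r} {d} {d′} {r₁} {r₂} _ r₂<n d<n _ (wrap e₁) (noWrap e₂) =
    trans (<ᵇ-false (<⇒≤ (+-cancelʳ-< r _ _ (subst₂ _<_ (sym e₂) (sym e₁) (<-≤-trans r₂<n (m≤n+m n r₁))))))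
          (sym (cyclic-by r r₁ r₂ (<ᵇ-true (wrap⇒< {r} {d} d<n e₁))
                          (<ᵇ-true (<-≤-trans (wrap⇒< {r} {d} d<n e₁) (noWrap⇒≤ {r} {d′} e₂)))
                          (<ᵇ-false (noWrap⇒≤ {r} {d′} e₂))))
  AddMod-<ᵇ-cyclic {r} {d} {d′} {r₁} {r₂} _ _ d<n d′<n (wrap e₁) (wrap e₂) =
    trans (<ᵇ-cong (λ d<d′ → +-cancelʳ-< n _ _ (subst₂ _<_ e₁ e₂ (+-monoˡ-< r d<d′)))
                   (λ r₁<r₂ → +-cancelʳ-< r _ _ (subst₂ _<_ (sym e₁) (sym e₂) (+-monoˡ-< n r₁<r₂))))
          (sym (trans (cyclic-by r r₁ r₂ (<ᵇ-true (wrap⇒< {r} {d} d<n e₁)) refl (<ᵇ-true (wrap⇒< {r} {d′} d′<n e₂)))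
                      (true-xor-true _)))

-- Rankings of a single cycle

iter-+ : ∀ {A : Set} a b (g : A → A) x → iter (a + b) g x ≡ iter a g (iter b g x)
iter-+ zero    b g x = refl
iter-+ (suc a) b g x = cong g (iter-+ a b g x)

iter-injective : ∀ {A : Set} {g : A → A} → (∀ {x y} → g x ≡ g y → x ≡ y) →
                 ∀ a {x y} → iter a g x ≡ iter a g y → x ≡ y
iter-injective inj zero    e = e
iter-injective inj (suc a) e = iter-injective inj a (inj e)

iter-preserves : ∀ {A : Set} {g : A → A} (P : A → Set) → (∀ {x} → P x → P (g x)) →
                 ∀ k {x} → P x → P (iter k g x)
iter-preserves P step zero    p = p
iter-preserves P step (suc k) p = step (iter-preserves P step k p)

-- Ranks 0, …, n-1 along τ: a witness that τ is a single n-cycle.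
record Ranking {n : ℕ} (τ : Fin n → Fin n) : Set where
  field
    rank           : Fin n → ℕ
    rank<n         : ∀ x → rank x < n
    rank-injective : ∀ {x y} → rank x ≡ rank y → x ≡ y
    rank-step      : ∀ x → AddMod n (rank x) 1 (rank (τ x))

  rank-iter : ∀ x m → m < n → AddMod n (rank x) m (rank (iter m τ x))
  rank-iter x zero    _   = AddMod-zero (rank x)
  rank-iter x (suc m) m<n =
    AddMod-suc (rank<n x) m<n (rank-iter x m (<-trans (n<1+n m) m<n)) (rank-step (iter m τ x))

  iter-injective-below : ∀ x {i j} → i < n → j < n → iter i τ x ≡ iter j τ x → i ≡ j
  iter-injective-below x {i} {j} i<n j<n e =
    AddMod-offset-unique i<n j<n (rank-iter x i i<n) (subst (AddMod n (rank x) j ∘ rank) (sym e) (rank-iter x j j<n))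

  offset : ∀ x y → ∃ λ m → m < n × iter m τ x ≡ y × AddMod n (rank x) m (rank y)
  offset x y with AddMod-exists (rank<n x) (rank<n y)
  ... | m , m<n , A = m , m<n , rank-injective (AddMod-functional (rank<n _) (rank<n y) (rank-iter x m m<n) A) , A

module Ranked {n : ℕ} (M : Map n) {τ : Fin n → Fin n} (R : Ranking τ) where
  open Ranking R

  single-cycle : IsSingleCycle M τ
  single-cycle x y = proj₁ (offset x y) , proj₁ (proj₂ (proj₂ (offset x y)))

  between-reflects : ∀ x y z → y ≢ x → Reflects (Between M τ x y z) (cyclic (rank x) (rank y) (rank z))
  between-reflects x y z y≢x with offset x y | offset x z
  ... | dy , dy<n , dy↦y , Ay | dz , dz<n , dz↦z , Az =
    subst (Reflects (Between M τ x y z)) (AddMod-<ᵇ-cyclic (rank<n y) (rank<n z) dy<n dz<n Ay Az)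
          (fromEquivalence sound complete)
    where
    sound : T (dy <ᵇ dz) → Between M τ x y z
    sound dy<dz = dy , dz , n≢0⇒n>0 (λ { refl → y≢x (sym dy↦y) }) , <ᵇ⇒< dy dz dy<dz , dz<n , dy↦y , dz↦z
    complete : Between M τ x y z → T (dy <ᵇ dz)
    complete (i , j , _ , i<j , j<n , i↦y , j↦z) =
      <⇒<ᵇ (subst₂ _<_ (iter-injective-below x i<n dy<n (trans i↦y (sym dy↦y)))
                       (iter-injective-below x j<n dz<n (trans j↦z (sym dz↦z))) i<j)
      where i<n = <-trans i<j j<n

  ¬between-start : ∀ x z → ¬ Between M τ x x z
  ¬between-start x z (i , j , 0<i , i<j , j<n , i↦x , _) =
    <-irrefl (iter-injective-below x (≤-<-trans z≤n i<n) i<n (sym i↦x)) 0<i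
    where i<n = <-trans i<j j<n

  ¬between-end : ∀ x y → ¬ Between M τ x y y
  ¬between-end x y (i , j , _ , i<j , j<n , i↦y , j↦y) =
    <-irrefl (iter-injective-below x (<-trans i<j j<n) j<n (trans i↦y (sym j↦y))) i<j

module _ {n : ℕ} (M : Map n) where
  open Map M

  OnEdge : Fin n → Fin n → Set
  OnEdge u x = x ≡ u ⊎ x ≡ α' M u

  OnEdge-sym : ∀ {u v} → OnEdge u v → OnEdge v u
  OnEdge-sym (inj₁ v≡u)  = inj₁ (sym v≡u)
  OnEdge-sym {u} (inj₂ v≡αu) = inj₂ (sym (trans (cong (α' M) v≡αu) (α-invol u)))

  OnEdge-trans : ∀ {u v x} → OnEdge u v → OnEdge v x → OnEdge u x
  OnEdge-trans (inj₁ refl) x∈v = x∈v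
  OnEdge-trans {u} (inj₂ refl) (inj₁ x≡αu)  = inj₂ x≡αu
  OnEdge-trans {u} (inj₂ refl) (inj₂ x≡ααu) = inj₁ (trans x≡ααu (α-invol u))

  distinctEdges? : ∀ x y → Dec (DistinctEdges M x y)
  distinctEdges? x y = ¬? (y ≟ᶠ x) ×-dec ¬? (y ≟ᶠ α' M x)

  ¬distinct⇒OnEdge : ∀ {u x} → ¬ DistinctEdges M u x → OnEdge u x
  ¬distinct⇒OnEdge {u} {x} ¬distinct with x ≟ᶠ u | x ≟ᶠ α' M u
  ... | yes x≡u | _         = inj₁ x≡u
  ... | no _    | yes x≡αu  = inj₂ x≡αu
  ... | no x≢u  | no x≢αu   = contradiction (x≢u , x≢αu) ¬distinct

  distinctEdgesᵇ : Fin n → Fin n → Bool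
  distinctEdgesᵇ x y = not (does (y ≟ᶠ x)) ∧ not (does (y ≟ᶠ α' M x))

  distinctEdges-reflects : ∀ x y → Reflects (DistinctEdges M x y) (distinctEdgesᵇ x y)
  distinctEdges-reflects x y = ¬-reflects (proof (y ≟ᶠ x)) ×-reflects ¬-reflects (proof (y ≟ᶠ α' M x))

  α-injective : ∀ {x y} → α' M x ≡ α' M y → x ≡ y
  α-injective {x} {y} e = trans (sym (α-invol x)) (trans (cong (α' M) e) (α-invol y))

module RankedCross {n : ℕ} (M : Map n) {τ : Fin n → Fin n} (R : Ranking τ) where
  open Map M
  open Ranking R
  open Ranked M R

  crossᵇ : Fin n → Fin n → Bool
  crossᵇ x y = distinctEdgesᵇ M x y
             ∧ (cyclic (rank x) (rank y) (rank (α' M x)) xor cyclic (rank x) (rank (α' M y)) (rank (α' M x)))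

  crossᵇ-distinct : ∀ x y → distinctEdgesᵇ M x y ≡ true →
                    crossᵇ x y ≡ cyclic (rank x) (rank y) (rank (α' M x)) xor cyclic (rank x) (rank (α' M y)) (rank (α' M x))
  crossᵇ-distinct _ _ d≡true rewrite d≡true = refl

  crossᵇ-same-edge : ∀ x y → distinctEdgesᵇ M x y ≡ false → crossᵇ x y ≡ false
  crossᵇ-same-edge _ _ d≡false rewrite d≡false = refl

  cross-reflects : ∀ x y → Reflects (Cross M τ x y) (crossᵇ x y)
  cross-reflects x y with distinctEdgesᵇ M x y | distinctEdges-reflects M x y
  ... | true  | ofʸ (y≢x , y≢αx) =
    xor-reflects (between-reflects x y (α' M x) y≢x)
                 (between-reflects x (α' M y) (α' M x) λ αy≡x → y≢αx (trans (sym (α-invol y)) (cong (α' M) αy≡x)))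
  ... | false | ofⁿ ¬distinct = ofⁿ (no-cross (y ≟ᶠ x))
    where
    no-cross : Dec (y ≡ x) → ¬ Cross M τ x y
    no-cross (yes refl) (inj₁ (b , _)) = ¬between-start x (α' M x) b
    no-cross (yes refl) (inj₂ (_ , b)) = ¬between-end x (α' M x) b
    no-cross (no y≢x) c with y ≟ᶠ α' M x
    ... | no y≢αx = ¬distinct (y≢x , y≢αx)
    no-cross (no _) (inj₁ (b , _)) | yes refl = ¬between-end x (α' M x) b
    no-cross (no _) (inj₂ (_ , b)) | yes refl =
      ¬between-start x (α' M x) (subst (λ u → Between M τ x u (α' M x)) (α-invol x) b)

module CycleRanking {n : ℕ} (M : Map n) {τ : Fin n → Fin n} (τ-injective : ∀ {x y} → τ x ≡ τ y → x ≡ y)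
                    (single : IsSingleCycle M τ) (o : Fin n) where

  orbit : ℕ → Fin n
  orbit r = iter r τ o

  n>0 : 0 < n
  n>0 = ≤-<-trans z≤n (Fin.toℕ<n o)

  orbit-cancel : ∀ a d → orbit (a + d) ≡ orbit a → orbit d ≡ o
  orbit-cancel a d e = iter-injective τ-injective a (trans (sym (iter-+ a d τ o)) e)

  orbit-mod-period : ∀ {d} → 0 < d → orbit d ≡ o → ∀ k → ∃ λ r → r < d × orbit r ≡ orbit k
  orbit-mod-period 0<d period zero = 0 , 0<d , refl
  orbit-mod-period {d} 0<d period (suc k) with orbit-mod-period 0<d period k
  ... | r , r<d , e with suc r <? d
  ...   | yes r+1<d = suc r , r+1<d , cong τ e
  ...   | no  r+1≮d = 0 , 0<d , trans (sym period) (trans (cong orbit (≤-antisym (≮⇒≥ r+1≮d) r<d)) (cong τ e))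

  periodic-covers : ∀ {d} → 0 < d → orbit d ≡ o → ∀ c → ∃ λ r → r < d × orbit r ≡ c
  periodic-covers 0<d period c =
    let (k , k↦c) = single o c
        (r , r<d , e) = orbit-mod-period 0<d period k
    in r , r<d , trans e k↦c

  period-≥ : ∀ {d} → 0 < d → orbit d ≡ o → n ≤ d
  period-≥ 0<d period = Fin.injective⇒≤ {f = position} position-injective
    where
    cover = periodic-covers 0<d period
    position : Fin n → Fin _
    position c = fromℕ< (proj₁ (proj₂ (cover c)))
    position-injective : ∀ {c c′} → position c ≡ position c′ → c ≡ c′
    position-injective {c} {c′} e =
      trans (sym (proj₂ (proj₂ (cover c))))
            (trans (cong orbit (trans (sym (Fin.toℕ-fromℕ< _)) (trans (cong toℕ e) (Fin.toℕ-fromℕ< _))))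
                   (proj₂ (proj₂ (cover c′))))

  orbit-n : orbit n ≡ o
  orbit-n with Fin.pigeonhole (n<1+n n) (λ (r : Fin (suc n)) → orbit (toℕ r))
  ... | a , b , a<b , e = subst (λ d → orbit d ≡ o) d≡n period
    where
    d = toℕ b ∸ toℕ a
    period : orbit d ≡ o
    period = orbit-cancel (toℕ a) d (trans (cong orbit (m+[n∸m]≡n (<⇒≤ a<b))) (sym e))
    d≡n : d ≡ n
    d≡n = ≤-antisym (≤-trans (m∸n≤m (toℕ b) (toℕ a)) (Fin.toℕ≤pred[n] b)) (period-≥ (m<n⇒0<n∸m a<b) period)

  orbit-≢ : ∀ {a b} → a < b → b < n → orbit a ≢ orbit b
  orbit-≢ {a} {b} a<b b<n e = <⇒≱ (≤-<-trans (m∸n≤m b a) b<n)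
    (period-≥ (m<n⇒0<n∸m a<b) (orbit-cancel a (b ∸ a) (trans (cong orbit (m+[n∸m]≡n (<⇒≤ a<b))) (sym e))))

  orbit-injective : ∀ {a b} → a < n → b < n → orbit a ≡ orbit b → a ≡ b
  orbit-injective {a} {b} a<n b<n e with <-cmp a b
  ... | tri≈ _ a≡b _ = a≡b
  ... | tri< a<b _ _ = ⊥-elim (orbit-≢ a<b b<n e)
  ... | tri> _ _ b<a = ⊥-elim (orbit-≢ b<a a<n (sym e))

  -- kept abstract: unfolding this search in later goals makes type checking blow up
  abstract
    reach : ∀ c → ∃ λ r → r < n × orbit r ≡ c
    reach = periodic-covers n>0 orbit-n

  rank : Fin n → ℕ
  rank c = proj₁ (reach c)

  rank<n : ∀ c → rank c < n
  rank<n c = proj₁ (proj₂ (reach c))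

  orbit-rank : ∀ c → orbit (rank c) ≡ c
  orbit-rank c = proj₂ (proj₂ (reach c))

  rank-orbit : ∀ {r} → r < n → rank (orbit r) ≡ r
  rank-orbit r<n = orbit-injective (rank<n _) r<n (orbit-rank _)

  rank-base : rank o ≡ 0
  rank-base = rank-orbit n>0

  rank-step : ∀ c → AddMod n (rank c) 1 (rank (τ c))
  rank-step c with suc (rank c) <? n
  ... | yes r+1<n = noWrap (sym (trans (cong (rank ∘ τ) (sym (orbit-rank c))) (rank-orbit r+1<n)))
  ... | no  r+1≮n = wrap (trans r+1≡n (cong (_+ n) (sym (trans (cong rank τc≡o) rank-base))))
    where
    r+1≡n : suc (rank c) ≡ n
    r+1≡n = ≤-antisym (rank<n c) (≮⇒≥ r+1≮n)
    τc≡o : τ c ≡ o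
    τc≡o = trans (cong τ (sym (orbit-rank c))) (trans (cong orbit r+1≡n) orbit-n)

  ranking : Ranking τ
  ranking = record
    { rank           = rank
    ; rank<n         = rank<n
    ; rank-injective = λ e → trans (sym (orbit-rank _)) (trans (cong orbit e) (orbit-rank _))
    ; rank-step      = rank-step
    }

-- Exchanging segments of a cycle

indicator : Bool → ℕ
indicator false = 0
indicator true  = 1

indicator-<ᵇ-mono : ∀ t {p q} → p ≤ q → indicator (t <ᵇ p) ≤ indicator (t <ᵇ q)
indicator-<ᵇ-mono t {p} {q} p≤q with t <ᵇ p | <ᵇ-reflects-< t p | t <ᵇ q | <ᵇ-reflects-< t q
... | false | _       | _     | _       = z≤n
... | true  | _       | true  | _       = ≤-refl
... | true  | ofʸ t<p | false | ofⁿ t≮q = contradiction (<-≤-trans t<p p≤q) t≮q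

thresholdsBelow : ℕ → ℕ → ℕ → ℕ → ℕ → ℕ
thresholdsBelow a b c d p = indicator (a <ᵇ p) + indicator (b <ᵇ p) + indicator (c <ᵇ p) + indicator (d <ᵇ p)

thresholdsBelow-mono : ∀ a b c d {p q} → p ≤ q → thresholdsBelow a b c d p ≤ thresholdsBelow a b c d q
thresholdsBelow-mono a b c d p≤q =
  +-mono-≤ (+-mono-≤ (+-mono-≤ (indicator-<ᵇ-mono a p≤q) (indicator-<ᵇ-mono b p≤q)) (indicator-<ᵇ-mono c p≤q))
           (indicator-<ᵇ-mono d p≤q)

thresholdsBelow-by : ∀ a b c d p {w x y z} → (a <ᵇ p) ≡ w → (b <ᵇ p) ≡ x → (c <ᵇ p) ≡ y → (d <ᵇ p) ≡ z →
                     thresholdsBelow a b c d p ≡ indicator w + indicator x + indicator y + indicator z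
thresholdsBelow-by _ _ _ _ _ refl refl refl refl = refl

reorder : ℕ → ℕ
reorder 1 = 3
reorder 3 = 1
reorder s = s

-- comparisons of positions in segments s and s′ that the exchange turns around
flip : ℕ → ℕ → Bool
flip s s′ = (s <ᵇ s′) xor (reorder s <ᵇ reorder s′)

-- whether a chord with ends in segments s, s′ crosses the chord of e (ranks 0 and j) ...
crossesE : ℕ → ℕ → Bool
crossesE s s′ = (s <ᵇ 3) xor (s′ <ᵇ 3)

-- ... and the chord of f (ranks i and k)
crossesF : ℕ → ℕ → Bool
crossesF s s′ = ((s <ᵇ 2) xor (s <ᵇ 4)) xor ((s′ <ᵇ 2) xor (s′ <ᵇ 4))

-- how the exchange changes the cyclic order of three points in segments sa, sb, sc ...
cyclicFlip : ℕ → ℕ → ℕ → Bool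
cyclicFlip sa sb sc = (flip sb sa xor flip sb sc) xor flip sc sa

-- ... and the crossing of two chords with ends in segments sx, sx′ and sy, sy′
crossFlip : ℕ → ℕ → ℕ → ℕ → Bool
crossFlip sx sx′ sy sy′ = cyclicFlip sx sy sx′ xor cyclicFlip sx sy′ sx′

-- Cutting a cycle 0, 1, …, N-1 at 0 < i < j < k and reading its segments (0,i], (i,j], (j,k]
-- in the order (j,k], (i,j], (0,i] gives the new position  exchange p  of p.
module SegmentExchange {i j k N : ℕ} (0<i : 0 < i) (i<j : i < j) (j<k : j < k) (k<N : k < N) where

  exchange : ℕ → ℕ
  exchange p = if 0 <ᵇ p then (if i <ᵇ p then (if j <ᵇ p then (if k <ᵇ p then p else p ∸ j)
                                                          else (p ∸ i) + (k ∸ j))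
                                         else p + (k ∸ i))
               else 0

  segment : ℕ → ℕ
  segment = thresholdsBelow 0 i j k

  segment′ : ℕ → ℕ
  segment′ = thresholdsBelow 0 (k ∸ j) (k ∸ i) k

  i<k = <-trans i<j j<k
  0<j = <-trans 0<i i<j
  0<k = <-trans 0<j j<k

  data Segment : ℕ → ℕ → Set where
    start  : Segment 0 0
    first  : ∀ {p} → 0 < p → p ≤ i → Segment p 1
    second : ∀ {p} → i < p → p ≤ j → Segment p 2
    third  : ∀ {p} → j < p → p ≤ k → Segment p 3
    rest   : ∀ {p} → k < p → Segment p 4

  classify : ∀ p → ∃ (Segment p)
  classify zero = 0 , start
  classify p@(suc _) with p ≤? i | p ≤? j | p ≤? k
  ... | yes p≤i | _       | _       = 1 , first z<s p≤i
  ... | no  p≰i | yes p≤j | _       = 2 , second (≰⇒> p≰i) p≤j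
  ... | no  _   | no  p≰j | yes p≤k = 3 , third (≰⇒> p≰j) p≤k
  ... | no  _   | no  _   | no  p≰k = 4 , rest (≰⇒> p≰k)

  segment-index : ∀ {p s} → Segment p s → segment p ≡ s
  segment-index start = refl
  segment-index {p} (first 0<p p≤i) =
    thresholdsBelow-by 0 i j k p (<ᵇ-true 0<p) (<ᵇ-false p≤i)
                       (<ᵇ-false (≤-trans p≤i (<⇒≤ i<j))) (<ᵇ-false (≤-trans p≤i (<⇒≤ i<k)))
  segment-index {p} (second i<p p≤j) =
    thresholdsBelow-by 0 i j k p (<ᵇ-true (<-trans 0<i i<p)) (<ᵇ-true i<p)
                       (<ᵇ-false p≤j) (<ᵇ-false (≤-trans p≤j (<⇒≤ j<k)))
  segment-index {p} (third j<p p≤k) =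
    thresholdsBelow-by 0 i j k p (<ᵇ-true (<-trans 0<j j<p)) (<ᵇ-true (<-trans i<j j<p)) (<ᵇ-true j<p) (<ᵇ-false p≤k)
  segment-index {p} (rest k<p) =
    thresholdsBelow-by 0 i j k p (<ᵇ-true (<-trans 0<k k<p)) (<ᵇ-true (<-trans i<k k<p)) (<ᵇ-true (<-trans j<k k<p)) (<ᵇ-true k<p)

  segment-of : ∀ p → Segment p (segment p)
  segment-of p = subst (Segment p) (sym (segment-index (proj₂ (classify p)))) (proj₂ (classify p))

  exchange-first : ∀ {p} → 0 < p → p ≤ i → exchange p ≡ p + (k ∸ i)
  exchange-first 0<p p≤i rewrite <ᵇ-true 0<p | <ᵇ-false p≤i = refl

  exchange-second : ∀ {p} → i < p → p ≤ j → exchange p ≡ (p ∸ i) + (k ∸ j)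
  exchange-second i<p p≤j rewrite <ᵇ-true (<-trans 0<i i<p) | <ᵇ-true i<p | <ᵇ-false p≤j = refl

  exchange-third : ∀ {p} → j < p → p ≤ k → exchange p ≡ p ∸ j
  exchange-third j<p p≤k
    rewrite <ᵇ-true (<-trans 0<j j<p) | <ᵇ-true (<-trans i<j j<p) | <ᵇ-true j<p | <ᵇ-false p≤k = refl

  exchange-rest : ∀ {p} → k < p → exchange p ≡ p
  exchange-rest k<p
    rewrite <ᵇ-true (<-trans 0<k k<p) | <ᵇ-true (<-trans i<k k<p) | <ᵇ-true (<-trans j<k k<p) | <ᵇ-true k<p = refl

  private
    k∸j≤k∸i : k ∸ j ≤ k ∸ i
    k∸j≤k∸i = ∸-monoʳ-≤ k (<⇒≤ i<j)

    j∸i+k∸j≡k∸i : (j ∸ i) + (k ∸ j) ≡ k ∸ i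
    j∸i+k∸j≡k∸i = +-cancelˡ-≡ i _ _ (begin
      i + ((j ∸ i) + (k ∸ j)) ≡⟨ sym (+-assoc i (j ∸ i) (k ∸ j)) ⟩
      (i + (j ∸ i)) + (k ∸ j) ≡⟨ cong (_+ (k ∸ j)) (m+[n∸m]≡n (<⇒≤ i<j)) ⟩
      j + (k ∸ j)             ≡⟨ m+[n∸m]≡n (<⇒≤ j<k) ⟩
      k                       ≡⟨ sym (m+[n∸m]≡n (<⇒≤ i<k)) ⟩
      i + (k ∸ i)             ∎)
      where open ≡-Reasoning

  segment′-exchange : ∀ {p s} → Segment p s → segment′ (exchange p) ≡ reorder s
  segment′-exchange start = refl
  segment′-exchange {p} (first 0<p p≤i) rewrite exchange-first 0<p p≤i =
    thresholdsBelow-by 0 (k ∸ j) (k ∸ i) k (p + (k ∸ i))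
                       (<ᵇ-true (<-≤-trans 0<p (m≤m+n p _))) (<ᵇ-true (≤-<-trans k∸j≤k∸i above))
                       (<ᵇ-true above) (<ᵇ-false below)
    where
    above : k ∸ i < p + (k ∸ i)
    above = m<n+m (k ∸ i) 0<p
    below : p + (k ∸ i) ≤ k
    below = ≤-trans (+-monoˡ-≤ (k ∸ i) p≤i) (≤-reflexive (m+[n∸m]≡n (<⇒≤ i<k)))
  segment′-exchange {p} (second i<p p≤j) rewrite exchange-second i<p p≤j =
    thresholdsBelow-by 0 (k ∸ j) (k ∸ i) k ((p ∸ i) + (k ∸ j)) (<ᵇ-true (≤-<-trans z≤n above)) (<ᵇ-true above)
                       (<ᵇ-false below) (<ᵇ-false (≤-trans below (m∸n≤m k i)))
    where
    above : k ∸ j < (p ∸ i) + (k ∸ j)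
    above = m<n+m (k ∸ j) (m<n⇒0<n∸m i<p)
    below : (p ∸ i) + (k ∸ j) ≤ k ∸ i
    below = ≤-trans (+-monoˡ-≤ (k ∸ j) (∸-monoˡ-≤ i p≤j)) (≤-reflexive j∸i+k∸j≡k∸i)
  segment′-exchange {p} (third j<p p≤k) rewrite exchange-third j<p p≤k =
    thresholdsBelow-by 0 (k ∸ j) (k ∸ i) k (p ∸ j) (<ᵇ-true (m<n⇒0<n∸m j<p)) (<ᵇ-false below)
                       (<ᵇ-false (≤-trans below k∸j≤k∸i)) (<ᵇ-false (≤-trans below (m∸n≤m k j)))
    where
    below : p ∸ j ≤ k ∸ j
    below = ∸-monoˡ-≤ j p≤k
  segment′-exchange {p} (rest k<p) rewrite exchange-rest k<p =
    thresholdsBelow-by 0 (k ∸ j) (k ∸ i) k p (<ᵇ-true (<-trans 0<k k<p))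
                       (<ᵇ-true (≤-<-trans (m∸n≤m k j) k<p)) (<ᵇ-true (≤-<-trans (m∸n≤m k i) k<p)) (<ᵇ-true k<p)

  reorder-involutive : ∀ {p s} → Segment p s → reorder (reorder s) ≡ s
  reorder-involutive start        = refl
  reorder-involutive (first _ _)  = refl
  reorder-involutive (second _ _) = refl
  reorder-involutive (third _ _)  = refl
  reorder-involutive (rest _)     = refl

  segment-determined : ∀ {p q} → segment′ (exchange p) ≡ segment′ (exchange q) → segment p ≡ segment q
  segment-determined {p} {q} e = begin
    segment p                     ≡⟨ sym (reorder-involutive (segment-of p)) ⟩
    reorder (reorder (segment p)) ≡⟨ cong reorder (trans (sym (segment′-exchange (segment-of p)))
                                                         (trans e (segment′-exchange (segment-of q)))) ⟩
    reorder (reorder (segment q)) ≡⟨ reorder-involutive (segment-of q) ⟩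
    segment q                     ∎
    where open ≡-Reasoning

  exchange<N : ∀ {p} → p < N → exchange p < N
  exchange<N {p} p<N with classify p
  ... | _ , start          = p<N
  ... | _ , first 0<p p≤i  = subst (_< N) (sym (exchange-first 0<p p≤i))
                           (≤-<-trans (+-monoˡ-≤ (k ∸ i) p≤i) (subst (_< N) (sym (m+[n∸m]≡n (<⇒≤ i<k))) k<N))
  ... | _ , second i<p p≤j = subst (_< N) (sym (exchange-second i<p p≤j))
                           (≤-<-trans (+-monoˡ-≤ (k ∸ j) (∸-monoˡ-≤ i p≤j))
                                      (subst (_< N) (sym j∸i+k∸j≡k∸i) (≤-<-trans (m∸n≤m k i) k<N)))
  ... | _ , third j<p p≤k  = subst (_< N) (sym (exchange-third j<p p≤k))
                               (≤-<-trans (∸-monoˡ-≤ j p≤k) (≤-<-trans (m∸n≤m k j) k<N))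
  ... | _ , rest k<p       = subst (_< N) (sym (exchange-rest k<p)) p<N

  exchange-<ᵇ-same : ∀ {p q s} → Segment p s → Segment q s → (exchange p <ᵇ exchange q) ≡ (p <ᵇ q)
  exchange-<ᵇ-same start start = refl
  exchange-<ᵇ-same {p} {q} (first a b) (first c d) rewrite exchange-first a b | exchange-first c d =
    <ᵇ-transport (_+ (k ∸ i)) {p} {q} (+-monoˡ-< (k ∸ i)) (+-monoˡ-≤ (k ∸ i))
  exchange-<ᵇ-same {p} {q} (second a b) (second c d) rewrite exchange-second a b | exchange-second c d =
    <ᵇ-transport (λ x → (x ∸ i) + (k ∸ j)) {p} {q} (λ p<q → +-monoˡ-< (k ∸ j) (∸-monoˡ-< p<q (<⇒≤ a)))
                 (λ q≤p → +-monoˡ-≤ (k ∸ j) (∸-monoˡ-≤ i q≤p))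
  exchange-<ᵇ-same {p} {q} (third a b) (third c d) rewrite exchange-third a b | exchange-third c d =
    <ᵇ-transport (_∸ j) {p} {q} (λ p<q → ∸-monoˡ-< p<q (<⇒≤ a)) (∸-monoˡ-≤ j)
  exchange-<ᵇ-same {p} {q} (rest a) (rest c) rewrite exchange-rest a | exchange-rest c = refl

  exchange-<ᵇ : ∀ p q → (exchange p <ᵇ exchange q) ≡ (p <ᵇ q) xor flip (segment p) (segment q)
  exchange-<ᵇ p q with segment p ≟ segment q
  ... | yes same = begin
    exchange p <ᵇ exchange q                  ≡⟨ exchange-<ᵇ-same (segment-of p) (subst (Segment q) (sym same) (segment-of q)) ⟩
    p <ᵇ q                                    ≡⟨ sym (xor-identityʳ _) ⟩
    (p <ᵇ q) xor false
      ≡⟨ cong ((p <ᵇ q) xor_) (sym (subst (λ s → flip (segment p) s ≡ false) same flip-refl)) ⟩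
    (p <ᵇ q) xor flip (segment p) (segment q) ∎
    where
    open ≡-Reasoning
    flip-refl : flip (segment p) (segment p) ≡ false
    flip-refl = cong₂ _xor_ (<ᵇ-irrefl (segment p)) (<ᵇ-irrefl (reorder (segment p)))
  ... | no differ = begin
    exchange p <ᵇ exchange q
      ≡⟨ sym (<ᵇ-via-monotone segment′ (thresholdsBelow-mono _ _ _ _) {exchange p} {exchange q}
                              (differ ∘ segment-determined {p} {q})) ⟩
    segment′ (exchange p) <ᵇ segment′ (exchange q)
      ≡⟨ cong₂ _<ᵇ_ (segment′-exchange (segment-of p)) (segment′-exchange (segment-of q)) ⟩
    reorder (segment p) <ᵇ reorder (segment q) ≡⟨ sym (xor-cancelˡ a (reorder (segment p) <ᵇ reorder (segment q))) ⟩
    a xor flip (segment p) (segment q)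
      ≡⟨ cong (_xor flip (segment p) (segment q)) (<ᵇ-via-monotone segment (thresholdsBelow-mono _ _ _ _) {p} {q} differ) ⟩
    (p <ᵇ q) xor flip (segment p) (segment q) ∎
    where
    open ≡-Reasoning
    a = segment p <ᵇ segment q

  exchange-injective : ∀ {p q} → exchange p ≡ exchange q → p ≡ q
  exchange-injective {p} {q} e = ≤-antisym (below e) (below (sym e))
    where
    below : ∀ {p q} → exchange p ≡ exchange q → p ≤ q
    below {p} {q} e = <ᵇ-false⇒≥ (trans (sym same-order) (trans (cong (_<ᵇ exchange p) (sym e)) (<ᵇ-irrefl (exchange p))))
      where
      same-order : (exchange q <ᵇ exchange p) ≡ (q <ᵇ p)
      same-order = exchange-<ᵇ-same (segment-of q)
                     (subst (Segment p) (segment-determined {p} {q} (cong segment′ e)) (segment-of p))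

  private
    no-wrap : ∀ {p p′} → suc p < N → ¬ (suc p ≡ p′ + N)
    no-wrap {p′ = p′} p+1<N e = <⇒≱ p+1<N (subst (N ≤_) (sym e) (m≤n+m N p′))

  exchange-suc : ∀ {p} → p ≢ 0 → p ≢ i → p ≢ j → p ≢ k → exchange (suc p) ≡ suc (exchange p)
  exchange-suc {p} p≢0 p≢i p≢j p≢k with classify p
  ... | _ , start          = contradiction refl p≢0
  ... | _ , first 0<p p≤i
    rewrite exchange-first 0<p p≤i | exchange-first z<s (≤∧≢⇒< p≤i p≢i) = refl
  ... | _ , second i<p p≤j
    rewrite exchange-second i<p p≤j | exchange-second (<-trans i<p (n<1+n p)) (≤∧≢⇒< p≤j p≢j)
          | +-∸-assoc 1 (<⇒≤ i<p) = refl
  ... | _ , third j<p p≤k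
    rewrite exchange-third j<p p≤k | exchange-third (<-trans j<p (n<1+n p)) (≤∧≢⇒< p≤k p≢k)
          | +-∸-assoc 1 (<⇒≤ j<p) = refl
  ... | _ , rest k<p
    rewrite exchange-rest k<p | exchange-rest (<-trans k<p (n<1+n p)) = refl

  -- Away from the cut points, stepping along the cycle commutes with the exchange; at the cut
  -- points 0, j, i, k one steps instead from j, 0, k, i, respectively.
  exchange-step : ∀ {p p′} → p < N → p ≢ 0 → p ≢ i → p ≢ j → p ≢ k →
                  AddMod N p 1 p′ → AddMod N (exchange p) 1 (exchange p′)
  exchange-step _ p≢0 p≢i p≢j p≢k (noWrap refl) = noWrap (sym (exchange-suc p≢0 p≢i p≢j p≢k))
  exchange-step {p} {p′} p<N _ _ _ p≢k (wrap e) =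
    wrap (trans (cong suc (exchange-rest k<p)) (trans e (cong (_+ N) p′≡exchange-p′)))
    where
    p′≡0 = wrap-to-0 p<N e
    p′≡exchange-p′ : p′ ≡ exchange p′
    p′≡exchange-p′ = trans p′≡0 (sym (cong exchange p′≡0))
    k<p = ≤∧≢⇒< (s≤s⁻¹ (subst (k <_) (trans (cong (_+ N) (sym p′≡0)) (sym e)) k<N)) (p≢k ∘ sym)

  exchange-step-0 : ∀ {p′} → AddMod N j 1 p′ → AddMod N (exchange 0) 1 (exchange p′)
  exchange-step-0 (noWrap refl) = noWrap (sym (trans (exchange-third (n<1+n j) j<k) (m+n∸n≡m 1 j)))
  exchange-step-0 (wrap e)      = contradiction e (no-wrap (≤-<-trans j<k k<N))

  exchange-step-j : ∀ {p′} → AddMod N 0 1 p′ → AddMod N (exchange j) 1 (exchange p′)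
  exchange-step-j (noWrap refl) =
    noWrap (trans (cong suc (trans (exchange-second i<j ≤-refl) j∸i+k∸j≡k∸i)) (sym (exchange-first z<s 0<i)))
  exchange-step-j (wrap e)      = contradiction e (no-wrap (≤-<-trans 0<k k<N))

  exchange-i : exchange i ≡ k
  exchange-i = trans (exchange-first 0<i ≤-refl) (m+[n∸m]≡n (<⇒≤ i<k))

  exchange-step-i : ∀ {p′} → AddMod N k 1 p′ → AddMod N (exchange i) 1 (exchange p′)
  exchange-step-i (noWrap refl) =
    noWrap (trans (cong suc exchange-i) (sym (exchange-rest (n<1+n k))))
  exchange-step-i {p′} (wrap e) =
    wrap (trans (cong suc exchange-i) (trans e (cong (_+ N) (trans p′≡0 (sym (cong exchange p′≡0))))))
    where p′≡0 = wrap-to-0 k<N e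

  exchange-step-k : ∀ {p′} → AddMod N i 1 p′ → AddMod N (exchange k) 1 (exchange p′)
  exchange-step-k (noWrap refl) =
    noWrap (trans (cong suc (exchange-third j<k ≤-refl))
                  (sym (trans (exchange-second (n<1+n i) i<j) (cong (_+ (k ∸ j)) (m+n∸n≡m 1 i)))))
  exchange-step-k (wrap e)      = contradiction e (no-wrap (≤-<-trans i<k k<N))

  <ᵇ-i : ∀ {p s} → Segment p s → p ≢ i → (p <ᵇ i) ≡ (s <ᵇ 2)
  <ᵇ-i start            _   = <ᵇ-true 0<i
  <ᵇ-i (first _ p≤i)    p≢i = <ᵇ-true (≤∧≢⇒< p≤i p≢i)
  <ᵇ-i (second i<p _)   _   = <ᵇ-false (<⇒≤ i<p)
  <ᵇ-i (third j<p _)    _   = <ᵇ-false (<⇒≤ (<-trans i<j j<p))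
  <ᵇ-i (rest k<p)       _   = <ᵇ-false (<⇒≤ (<-trans i<k k<p))

  <ᵇ-j : ∀ {p s} → Segment p s → p ≢ j → (p <ᵇ j) ≡ (s <ᵇ 3)
  <ᵇ-j start            _   = <ᵇ-true 0<j
  <ᵇ-j (first _ p≤i)    _   = <ᵇ-true (≤-<-trans p≤i i<j)
  <ᵇ-j (second _ p≤j)   p≢j = <ᵇ-true (≤∧≢⇒< p≤j p≢j)
  <ᵇ-j (third j<p _)    _   = <ᵇ-false (<⇒≤ j<p)
  <ᵇ-j (rest k<p)       _   = <ᵇ-false (<⇒≤ (<-trans j<k k<p))

  <ᵇ-k : ∀ {p s} → Segment p s → p ≢ k → (p <ᵇ k) ≡ (s <ᵇ 4)
  <ᵇ-k start            _   = <ᵇ-true 0<k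
  <ᵇ-k (first _ p≤i)    _   = <ᵇ-true (≤-<-trans p≤i i<k)
  <ᵇ-k (second _ p≤j)   _   = <ᵇ-true (≤-<-trans p≤j j<k)
  <ᵇ-k (third _ p≤k)    p≢k = <ᵇ-true (≤∧≢⇒< p≤k p≢k)
  <ᵇ-k (rest k<p)       _   = <ᵇ-false (<⇒≤ k<p)


  segment<5 : ∀ {p s} → Segment p s → s < 5
  segment<5 start        = s≤s z≤n
  segment<5 (first _ _)  = s≤s (s≤s z≤n)
  segment<5 (second _ _) = s≤s (s≤s (s≤s z≤n))
  segment<5 (third _ _)  = s≤s (s≤s (s≤s (s≤s z≤n)))
  segment<5 (rest _)     = ≤-refl

  segment-zero : ∀ {p} → Segment p 0 → p ≡ 0
  segment-zero start = refl

  cyclic-exchange : ∀ a b c → cyclic (exchange a) (exchange b) (exchange c)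
                              ≡ cyclic a b c xor cyclicFlip (segment a) (segment b) (segment c)
  cyclic-exchange a b c = begin
    cyclic (exchange a) (exchange b) (exchange c)
      ≡⟨ cong₂ _xor_ (cong₂ _xor_ (exchange-<ᵇ b a) (exchange-<ᵇ b c)) (exchange-<ᵇ c a) ⟩
    (((b <ᵇ a) xor fba) xor ((b <ᵇ c) xor fbc)) xor ((c <ᵇ a) xor fca)
      ≡⟨ cong (_xor ((c <ᵇ a) xor fca)) (interchange (b <ᵇ a) fba (b <ᵇ c) fbc) ⟩
    (((b <ᵇ a) xor (b <ᵇ c)) xor (fba xor fbc)) xor ((c <ᵇ a) xor fca)
      ≡⟨ interchange ((b <ᵇ a) xor (b <ᵇ c)) (fba xor fbc) (c <ᵇ a) fca ⟩
    cyclic a b c xor cyclicFlip (segment a) (segment b) (segment c) ∎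
    where
    open ≡-Reasoning
    fba = flip (segment b) (segment a)
    fbc = flip (segment b) (segment c)
    fca = flip (segment c) (segment a)

-- Tours of symmetric differences

module _ {n : ℕ} (M : Map n) where
  open Map M

  σ-injective : ∀ {x y} → σ' M x ≡ σ' M y → x ≡ y
  σ-injective {x} {y} e = trans (sym (inverseˡ σ)) (trans (cong (σ ⟨$⟩ˡ_) e) (inverseˡ σ))

  tour-injective : ∀ {F} → IsEdgeSet M F → ∀ {x y} → tour M F x ≡ tour M F y → x ≡ y
  tour-injective {F} edgeSet {x} {y} e with F x in Fx | F y in Fy
  ... | true  | true  = α-injective M (σ-injective e)
  ... | false | false = σ-injective e
  ... | true  | false = contradiction (trans (sym Fx) (trans (sym (edgeSet x)) (trans (cong F (σ-injective e)) Fy))) λ ()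
  ... | false | true  = contradiction (trans (sym Fx) (trans (cong F (σ-injective e)) (trans (edgeSet y) Fy))) λ ()

  inEdge-α : ∀ u x → inEdge M u (α' M x) ≡ inEdge M u x
  inEdge-α u x = begin
    isYes (α' M x ≟ᶠ u) ∨ isYes (α' M x ≟ᶠ α' M u)
      ≡⟨ cong₂ _∨_ (isYes-cong (α' M x ≟ᶠ u) (x ≟ᶠ α' M u)
                               (λ αx≡u → trans (sym (α-invol x)) (cong (α' M) αx≡u))
                               (λ x≡αu → trans (cong (α' M) x≡αu) (α-invol u)))
                   (isYes-cong (α' M x ≟ᶠ α' M u) (x ≟ᶠ u) (α-injective M) (cong (α' M))) ⟩
    isYes (x ≟ᶠ α' M u) ∨ isYes (x ≟ᶠ u)         ≡⟨ ∨-comm (isYes (x ≟ᶠ α' M u)) (isYes (x ≟ᶠ u)) ⟩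
    isYes (x ≟ᶠ u) ∨ isYes (x ≟ᶠ α' M u)         ∎
    where
    open ≡-Reasoning
    isYes-cong : ∀ {A B : Set} (a : Dec A) (b : Dec B) → (A → B) → (B → A) → isYes a ≡ isYes b
    isYes-cong (yes _)  (yes _)  _ _ = refl
    isYes-cong (yes p)  (no ¬q)  f _ = contradiction (f p) ¬q
    isYes-cong (no ¬p)  (yes q)  _ g = contradiction (g q) ¬p
    isYes-cong (no _)   (no _)   _ _ = refl

  inEdge-self : ∀ u {x} → OnEdge M u x → inEdge M u x ≡ true
  inEdge-self u {x} (inj₁ x≡u) with x ≟ᶠ u
  ... | yes _   = refl
  ... | no x≢u  = contradiction x≡u x≢u
  inEdge-self u {x} (inj₂ x≡αu) with x ≟ᶠ u | x ≟ᶠ α' M u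
  ... | yes _ | _      = refl
  ... | no _  | yes _  = refl
  ... | no _  | no x≢αu = contradiction x≡αu x≢αu

  inEdge-other : ∀ u {x} → x ≢ u → x ≢ α' M u → inEdge M u x ≡ false
  inEdge-other u {x} x≢u x≢αu with x ≟ᶠ u | x ≟ᶠ α' M u
  ... | yes x≡u | _        = contradiction x≡u x≢u
  ... | no _    | yes x≡αu = contradiction x≡αu x≢αu
  ... | no _    | no _     = refl

  onEdges : Fin n → Fin n → Fin n → Bool
  onEdges e f x = inEdge M e x ∨ inEdge M f x

  symDiff-isEdgeSet : ∀ {S} → IsEdgeSet M S → ∀ e f → IsEdgeSet M (symDiff M S e f)
  symDiff-isEdgeSet edgeSet e f x = cong₂ _xor_ (edgeSet x) (cong₂ _∨_ (inEdge-α e x) (inEdge-α f x))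

  tour-symDiff-off : ∀ S e f {x} → onEdges e f x ≡ false → tour M (symDiff M S e f) x ≡ tour M S x
  tour-symDiff-off S e f {x} off =
    cong (λ b → if b then σ' M (α' M x) else σ' M x) (trans (cong (S x xor_) off) (xor-identityʳ (S x)))

  tour-symDiff-on : ∀ {S} → IsEdgeSet M S → ∀ e f {x} → onEdges e f x ≡ true →
                    tour M (symDiff M S e f) x ≡ tour M S (α' M x)
  tour-symDiff-on {S} edgeSet e f {x} on =
    trans (cong (λ b → if S x xor b then σ' M (α' M x) else σ' M x) on) (flipped (S x) (edgeSet x))
    where
    flipped : ∀ s → S (α' M x) ≡ s →
              (if s xor true then σ' M (α' M x) else σ' M x) ≡ tour M S (α' M x)
    flipped true  Sαx = trans (cong (σ' M) (sym (α-invol x))) (cong (λ b → if b then _ else σ' M (α' M x)) (sym Sαx))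
    flipped false Sαx = cong (λ b → if b then σ' M (α' M (α' M x)) else _) (sym Sαx)

-- adjacency of x, y after local complementation at v (d: x, y are distinct edges;
-- a, b: v is adjacent to x, y; c: x is adjacent to y)
localComplementᵇ : Bool → Bool → Bool → Bool → Bool
localComplementᵇ d a b c = (d ∧ a ∧ b ∧ not c) ∨ (not (d ∧ a ∧ b) ∧ c)

module _ {n : ℕ} (M : Map n) where

  _∗ᵇ_ : (Fin n → Fin n → Bool) → Fin n → Fin n → Fin n → Bool
  (g ∗ᵇ v) x y = localComplementᵇ (distinctEdgesᵇ M x y) (g v x) (g v y) (g x y)

  pivotᵇ : (Fin n → Fin n → Bool) → Fin n → Fin n → Fin n → Fin n → Bool
  pivotᵇ g u v = ((g ∗ᵇ u) ∗ᵇ v) ∗ᵇ u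

  module _ (G : CGraph n) (g : Fin n → Fin n → Bool) (G-reflects : ∀ x y → Reflects (CGraph.adj G x y) (g x y)) where

    localComplement-reflects : ∀ v x y → Reflects (CGraph.adj (_∗_ M G v) x y) ((g ∗ᵇ v) x y)
    localComplement-reflects v x y =
      (distinctEdges-reflects M x y ×-reflects G-reflects v x ×-reflects G-reflects v y ×-reflects ¬-reflects (G-reflects x y))
      ⊎-reflects (¬-reflects (distinctEdges-reflects M x y ×-reflects G-reflects v x ×-reflects G-reflects v y)
                  ×-reflects G-reflects x y)

  pivot-reflects : (G : CGraph n) (g : Fin n → Fin n → Bool) → (∀ x y → Reflects (CGraph.adj G x y) (g x y)) →
                   ∀ u v x y → Reflects (CGraph.adj (pivot M G u v) x y) (pivotᵇ g u v x y)
  pivot-reflects G g G-reflects u v =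
    localComplement-reflects (_∗_ M (_∗_ M G u) v) _
      (localComplement-reflects (_∗_ M G u) _ (localComplement-reflects G g G-reflects u) v) u

-- pivotᵇ g u v x y, as a function of the adjacencies among u, v, x, y and which of them are distinct edges
pivotFormula : (Auv Auu Avu Aux Avx Auy Avy Axy dxy dux duy dvu dvx dvy : Bool) → Bool
pivotFormula Auv Auu Avu Aux Avx Auy Avy Axy dxy dux duy dvu dvx dvy =
  lc dxy (lc dux (lc dvu Auv Auu Avu) (lc dvx Auv Aux Avx) (lc dux Auu Aux Aux))
         (lc duy (lc dvu Auv Auu Avu) (lc dvy Auv Auy Avy) (lc duy Auu Auy Auy))
         (lc dxy (lc dvx Auv Aux Avx) (lc dvy Auv Auy Avy) (lc dxy Aux Auy Axy))
  where lc = localComplementᵇ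

∧-true : ∀ {a b} → a ∧ b ≡ true → a ≡ true × b ≡ true
∧-true {true} {true} _ = refl , refl

allBelow : ℕ → (ℕ → Bool) → Bool
allBelow zero    g = true
allBelow (suc m) g = allBelow m g ∧ g m

allBelow-sound : ∀ m g → allBelow m g ≡ true → ∀ {a} → a < m → g a ≡ true
allBelow-sound (suc m) g all {a} a<1+m with ∧-true {allBelow m g} all | a ≟ m
... | _       , gm | yes refl = gm
... | earlier , _  | no a≢m   = allBelow-sound m g earlier (≤∧≢⇒< (s≤s⁻¹ a<1+m) a≢m)

allBool : (Bool → Bool) → Bool
allBool g = g true ∧ g false

allBool-sound : ∀ g → allBool g ≡ true → ∀ b → g b ≡ true
allBool-sound g all true  = proj₁ (∧-true all)
allBool-sound g all false = proj₂ (∧-true {g true} all)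

-- The combinations that occur for a flag x: whether x lies off the edges of e and of f, and the
-- segments of x and α x.  The flags of e are cut points 0 and j, those of f are i and k.
admissible : Bool → Bool → ℕ → ℕ → Bool
admissible de df s s′ =
  if not de then df ∧ (((s ≡ᵇ 0) ∧ (s′ ≡ᵇ 2)) ∨ ((s ≡ᵇ 2) ∧ (s′ ≡ᵇ 0)))
  else if not df then ((s ≡ᵇ 1) ∧ (s′ ≡ᵇ 3)) ∨ ((s ≡ᵇ 3) ∧ (s′ ≡ᵇ 1))
  else not (s ≡ᵇ 0) ∧ not (s′ ≡ᵇ 0)

-- pivotᵇ g e f x y for crossing e, f and x, y on distinct edges, in terms of the segments of x, α x, y, α y
pivotOnCrossing : (sx sx′ sy sy′ : ℕ) (dex dfx dey dfy b : Bool) → Bool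
pivotOnCrossing sx sx′ sy sy′ dex dfx dey dfy b =
  pivotFormula true false true (dex ∧ crossesE sx sx′) (dfx ∧ crossesF sx sx′)
               (dey ∧ crossesE sy sy′) (dfy ∧ crossesF sy sy′) b true dex dey true dfx dfy

allBools : (Bool → Bool → Bool → Bool → Bool → Bool) → Bool
allBools r = allBool λ a → allBool λ b → allBool λ c → allBool λ d → allBool (r a b c d)

allBools-sound : ∀ r → allBools r ≡ true → ∀ a b c d e → r a b c d e ≡ true
allBools-sound r all a b c d =
  allBool-sound (r a b c d)
    (allBool-sound (λ d → allBool (r a b c d))
      (allBool-sound (λ c → allBool λ d → allBool (r a b c d))
        (allBool-sound (λ b → allBool λ c → allBool λ d → allBool (r a b c d))
          (allBool-sound (λ a → allBool λ b → allBool λ c → allBool λ d → allBool (r a b c d)) all a) b) c) d)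

allRows : (ℕ → ℕ → ℕ → ℕ → Bool → Bool → Bool → Bool → Bool → Bool) → Bool
allRows row = allBelow 5 λ sx → allBelow 5 λ sx′ → allBelow 5 λ sy → allBelow 5 λ sy′ → allBools (row sx sx′ sy sy′)

allRows-sound : ∀ row → allRows row ≡ true → ∀ {sx sx′ sy sy′} → sx < 5 → sx′ < 5 → sy < 5 → sy′ < 5 →
                ∀ dex dfx dey dfy b → row sx sx′ sy sy′ dex dfx dey dfy b ≡ true
allRows-sound row all {sx} {sx′} {sy} sx<5 sx′<5 sy<5 sy′<5 =
  allBools-sound (row sx sx′ sy _)
    (allBelow-sound 5 (λ sy′ → allBools (row sx sx′ sy sy′))
      (allBelow-sound 5 (λ sy → allBelow 5 λ sy′ → allBools (row sx sx′ sy sy′))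
        (allBelow-sound 5 (λ sx′ → allBelow 5 λ sy → allBelow 5 λ sy′ → allBools (row sx sx′ sy sy′))
          (allBelow-sound 5 (λ sx → allBelow 5 λ sx′ → allBelow 5 λ sy → allBelow 5 λ sy′ → allBools (row sx sx′ sy sy′))
            all sx<5) sx′<5) sy<5) sy′<5)

pivotRow : ℕ → ℕ → ℕ → ℕ → Bool → Bool → Bool → Bool → Bool → Bool
pivotRow sx sx′ sy sy′ dex dfx dey dfy b =
  not (admissible dex dfx sx sx′ ∧ admissible dey dfy sy sy′ ∧ (dex ∨ dey))
  ∨ not ((b xor crossFlip sx sx′ sy sy′) xor pivotOnCrossing sx sx′ sy sy′ dex dfx dey dfy b)

pivot-table : ∀ {sx sx′ sy sy′} → sx < 5 → sx′ < 5 → sy < 5 → sy′ < 5 → ∀ dex dfx dey dfy b →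
  admissible dex dfx sx sx′ ≡ true → admissible dey dfy sy sy′ ≡ true → (dex ∨ dey) ≡ true →
  b xor crossFlip sx sx′ sy sy′ ≡ pivotOnCrossing sx sx′ sy sy′ dex dfx dey dfy b
pivot-table sx<5 sx′<5 sy<5 sy′<5 dex dfx dey dfy b adm-x adm-y off-e =
  xnor-true (row-holds (allRows-sound pivotRow refl sx<5 sx′<5 sy<5 sy′<5 dex dfx dey dfy b)
                   (cong not (trans (cong (_∧ _) adm-x) (trans (cong (_∧ (dex ∨ dey)) adm-y) off-e))))
  where
  row-holds : ∀ {a c} → (not a ∨ c) ≡ true → not a ≡ false → c ≡ true
  row-holds {true}  h _  = h
  row-holds {false} _ ()
  xnor-true : ∀ {a b} → not (a xor b) ≡ true → a ≡ b
  xnor-true {true}  {true}  _ = refl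
  xnor-true {false} {false} _ = refl

pivotᵇ-same-edge : ∀ {n} (M : Map n) g u v x y → distinctEdgesᵇ M x y ≡ false → pivotᵇ M g u v x y ≡ g x y
pivotᵇ-same-edge M g u v x y dxy rewrite dxy = refl

pivotᵇ-on-crossing : ∀ {n} (M : Map n) (g : Fin n → Fin n → Bool) u v x y {Aux Avx Auy Avy} →
  g u v ≡ true → g u u ≡ false → g v u ≡ true →
  g u x ≡ Aux → g v x ≡ Avx → g u y ≡ Auy → g v y ≡ Avy →
  distinctEdgesᵇ M x y ≡ true → distinctEdgesᵇ M v u ≡ true →
  pivotᵇ M g u v x y ≡ pivotFormula true false true Aux Avx Auy Avy (g x y) true
                                    (distinctEdgesᵇ M u x) (distinctEdgesᵇ M u y) true
                                    (distinctEdgesᵇ M v x) (distinctEdgesᵇ M v y)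
pivotᵇ-on-crossing M g u v x y guv guu gvu gux gvx guy gvy dxy dvu
  rewrite guv | guu | gvu | gux | gvx | guy | gvy | dxy | dvu = refl

-- Pivoting a quasi-tree

module PivotOnQuasiTree {n : ℕ} (M : Map n) (S : Fin n → Bool) (quasiTree : IsQuasiTree M S)
                        (e f : Fin n) (e-f-distinct : DistinctEdges M e f) where
  open Map M

  edgeSet : IsEdgeSet M S
  edgeSet = proj₁ quasiTree

  S′ : Fin n → Bool
  S′ = symDiff M S e f

  τ′ : Fin n → Fin n
  τ′ = tour M S′

  open CycleRanking M (tour-injective M edgeSet) (proj₂ quasiTree) e using (ranking; rank-base)
  open Ranking ranking
  module Old = RankedCross M ranking

  j : ℕ
  j = rank (α' M e)

  0<j : 0 < j
  0<j = n≢0⇒n>0 λ j≡0 → α-fpf e (rank-injective (trans j≡0 (sym rank-base)))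

  rank≡0⇒e : ∀ {x} → rank x ≡ 0 → x ≡ e
  rank≡0⇒e r≡0 = rank-injective (trans r≡0 (sym rank-base))

  off-e : ∀ {x} → x ≢ e → 0 < rank x
  off-e x≢e = n≢0⇒n>0 (x≢e ∘ rank≡0⇒e)

  on-e : ∀ {x} → OnEdge M e x → onEdges M e f x ≡ true
  on-e {x} x∈e = cong (_∨ inEdge M f x) (inEdge-self M e x∈e)

  on-f : ∀ {x} → OnEdge M f x → onEdges M e f x ≡ true
  on-f {x} x∈f = trans (cong (inEdge M e x ∨_) (inEdge-self M f x∈f)) (∨-zeroʳ _)

  step′-on : ∀ {x} → onEdges M e f x ≡ true → AddMod n (rank (α' M x)) 1 (rank (τ′ x))
  step′-on {x} on = subst (AddMod n (rank (α' M x)) 1 ∘ rank) (sym (tour-symDiff-on M edgeSet e f on)) (rank-step (α' M x))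

  step′-off : ∀ {x} → x ≢ e → x ≢ α' M e → x ≢ f → x ≢ α' M f → AddMod n (rank x) 1 (rank (τ′ x))
  step′-off {x} x≢e x≢αe x≢f x≢αf =
    subst (AddMod n (rank x) 1 ∘ rank) (sym (tour-symDiff-off M S e f off)) (rank-step x)
    where
    off : onEdges M e f x ≡ false
    off = cong₂ _∨_ (inEdge-other M e x≢e x≢αe) (inEdge-other M f x≢f x≢αf)

  step′-α : ∀ {x} → onEdges M e f (α' M x) ≡ true → AddMod n (rank x) 1 (rank (τ′ (α' M x)))
  step′-α {x} on = subst (λ y → AddMod n (rank y) 1 (rank (τ′ (α' M x)))) (α-invol x) (step′-on on)

  cyclic-from-e : ∀ r → cyclic (rank e) r j ≡ (r <ᵇ j)
  cyclic-from-e r rewrite rank-base = xor-identityʳ (r <ᵇ j)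

  crossᵇ-e : ∀ {x} → DistinctEdges M e x → Old.crossᵇ e x ≡ (rank x <ᵇ j) xor (rank (α' M x) <ᵇ j)
  crossᵇ-e {x} distinct =
    trans (Old.crossᵇ-distinct e x (reflects-true (distinctEdges-reflects M e x) distinct))
          (cong₂ _xor_ (cyclic-from-e (rank x)) (cyclic-from-e (rank (α' M x))))

  separated-reflects : Reflects (Cross M (tour M S) e f) ((rank f <ᵇ j) xor (rank (α' M f) <ᵇ j))
  separated-reflects = subst (Reflects _) (crossᵇ-e e-f-distinct) (Old.cross-reflects e f)

  not-single-cycle : (P : Fin n → Set) → (∀ {x} → P x → P (τ′ x)) → ∀ {a b} → P a → ¬ P b → ¬ IsSingleCycle M τ′
  not-single-cycle P closed {a} {b} Pa ¬Pb single =
    ¬Pb (subst P (proj₂ (single a b)) (iter-preserves P closed (proj₁ (single a b)) Pa))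

  -- If both ends of f lie on the same side of α e, then one of the two arcs between e and α e,
  -- together with the appropriate end of e, is closed under τ′.
  both-before : rank f < j → rank (α' M f) < j → ¬ IsSingleCycle M τ′
  both-before f<j αf<j = not-single-cycle (λ x → rank x ≡ 0 ⊎ j < rank x) closed (inj₁ rank-base) λ
    { (inj₁ j≡0) → <-irrefl (sym j≡0) 0<j ; (inj₂ j<j) → <-irrefl refl j<j }
    where
    closed : ∀ {x} → rank x ≡ 0 ⊎ j < rank x → rank (τ′ x) ≡ 0 ⊎ j < rank (τ′ x)
    closed (inj₁ r≡0) with rank≡0⇒e r≡0
    ... | refl with AddMod-one (rank<n (α' M e)) (step′-on (on-e (inj₁ refl)))
    ...   | inj₁ r′≡j+1 = inj₂ (subst (j <_) (sym r′≡j+1) (n<1+n j))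
    ...   | inj₂ (r′≡0 , _) = inj₁ r′≡0
    closed {x} (inj₂ j<r) with AddMod-one (rank<n x) (step′-off x≢e x≢αe x≢f x≢αf)
      where
      x≢e   = λ x≡e  → n≮0 (subst (j <_) (trans (cong rank x≡e) rank-base) j<r)
      x≢αe  = λ x≡αe → <-irrefl (cong rank (sym x≡αe)) j<r
      x≢f   = λ x≡f  → <-asym j<r (subst (_< j) (cong rank (sym x≡f)) f<j)
      x≢αf  = λ x≡αf → <-asym j<r (subst (_< j) (cong rank (sym x≡αf)) αf<j)
    ... | inj₁ r′≡r+1     = inj₂ (subst (j <_) (sym r′≡r+1) (<-trans j<r (n<1+n _)))
    ... | inj₂ (r′≡0 , _) = inj₁ r′≡0

  both-after : j < rank f → j < rank (α' M f) → ¬ IsSingleCycle M τ′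
  both-after j<f j<αf = not-single-cycle (λ x → 0 < rank x × rank x ≤ j) closed (0<j , ≤-refl)
    λ (0<r , _) → <-irrefl (sym rank-base) 0<r
    where
    closed : ∀ {x} → 0 < rank x × rank x ≤ j → 0 < rank (τ′ x) × rank (τ′ x) ≤ j
    closed {x} (0<r , r≤j) with m≤n⇒m<n∨m≡n r≤j
    ... | inj₂ r≡j with rank-injective r≡j
    ...   | refl with AddMod-one (rank<n e) (step′-α (on-e (inj₂ refl)))
    ...     | inj₁ r′≡1 rewrite rank-base = subst (0 <_) (sym r′≡1) z<s , subst (_≤ j) (sym r′≡1) 0<j
    ...     | inj₂ (_ , 1≡n) rewrite rank-base = contradiction (subst (j <_) (sym 1≡n) (rank<n (α' M e))) (≤⇒≯ 0<j)
    closed {x} (0<r , r≤j) | inj₁ r<j with AddMod-one (rank<n x) (step′-off x≢e x≢αe x≢f x≢αf)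
      where
      x≢e   = λ x≡e  → <-irrefl (sym (trans (cong rank x≡e) rank-base)) 0<r
      x≢αe  = λ x≡αe → <-irrefl (cong rank x≡αe) r<j
      x≢f   = λ x≡f  → <-asym r<j (subst (j <_) (cong rank (sym x≡f)) j<f)
      x≢αf  = λ x≡αf → <-asym r<j (subst (j <_) (cong rank (sym x≡αf)) j<αf)
    ... | inj₁ r′≡r+1      = subst (0 <_) (sym r′≡r+1) z<s , subst (_≤ j) (sym r′≡r+1) r<j
    ... | inj₂ (_ , r+1≡n) = contradiction (subst (j <_) (sym r+1≡n) (rank<n (α' M e))) (≤⇒≯ r<j)

  after-αe : ∀ {x} → rank x ≮ j → x ≢ α' M e → j < rank x
  after-αe x≮j x≢αe = ≤∧≢⇒< (≮⇒≥ x≮j) (λ j≡r → x≢αe (rank-injective (sym j≡r)))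

  f≢αe : f ≢ α' M e
  f≢αe = proj₂ e-f-distinct

  αf≢e : α' M f ≢ e
  αf≢e αf≡e = f≢αe (trans (sym (α-invol f)) (cong (α' M) αf≡e))

  αf≢αe : α' M f ≢ α' M e
  αf≢αe = proj₁ e-f-distinct ∘ α-injective M

  converse : IsQuasiTree M S′ → Cross M (tour M S) e f
  converse (_ , single′) with rank f <? j | rank (α' M f) <? j
  ... | yes f<j | no  αf≮j = reflects-sound separated-reflects (cong₂ _xor_ (<ᵇ-true f<j) (<ᵇ-false (≮⇒≥ αf≮j)))
  ... | no  f≮j | yes αf<j = reflects-sound separated-reflects (cong₂ _xor_ (<ᵇ-false (≮⇒≥ f≮j)) (<ᵇ-true αf<j))
  ... | yes f<j | yes αf<j = contradiction single′ (both-before f<j αf<j)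
  ... | no  f≮j | no  αf≮j = contradiction single′ (both-after (after-αe f≮j f≢αe) (after-αe αf≮j αf≢αe))

  distinct-true : ∀ {u x} → DistinctEdges M u x → distinctEdgesᵇ M u x ≡ true
  distinct-true {u} {x} = reflects-true (distinctEdges-reflects M u x)

  same-edge-false : ∀ {u x} → OnEdge M u x → distinctEdgesᵇ M u x ≡ false
  same-edge-false {u} {x} (inj₁ x≡u)  = reflects-false (distinctEdges-reflects M u x) λ (x≢u , _) → x≢u x≡u
  same-edge-false {u} {x} (inj₂ x≡αu) = reflects-false (distinctEdges-reflects M u x) λ (_ , x≢αu) → x≢αu x≡αu

  crossᵇ-guarded : ∀ u x {b} → (DistinctEdges M u x → Old.crossᵇ u x ≡ b) →
                   Old.crossᵇ u x ≡ distinctEdgesᵇ M u x ∧ b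
  crossᵇ-guarded u x {b} value with distinctEdges? M u x
  ... | yes d = trans (value d) (cong (_∧ b) (sym (distinct-true d)))
  ... | no ¬d = trans (Old.crossᵇ-same-edge u x d≡false) (cong (_∧ b) (sym d≡false))
    where d≡false = reflects-false (distinctEdges-reflects M u x) ¬d

  PivotResult : Set
  PivotResult = IsQuasiTree M S′ × (Λ̃ M S′ ≅ switchColours M (pivot M (Λ̃ M S) e f) e f)

  -- c is the end of f met before α e when walking along τ from e, c′ the one met after it
  module Crossing (c : Fin n) (c∈f : OnEdge M f c)
                  (0<i : 0 < rank c) (i<j : rank c < j) (j<k : j < rank (α' M c)) where

    c′ : Fin n
    c′ = α' M c

    i k : ℕ
    i = rank c
    k = rank c′

    open SegmentExchange 0<i i<j j<k (rank<n c′)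

    off-f : ∀ {x} → x ≢ c → x ≢ c′ → ¬ OnEdge M f x
    off-f x≢c x≢c′ x∈f with OnEdge-trans M (OnEdge-sym M c∈f) x∈f
    ... | inj₁ x≡c  = x≢c x≡c
    ... | inj₂ x≡c′ = x≢c′ x≡c′

    on-c : ∀ {x} → OnEdge M c x → onEdges M e f x ≡ true
    on-c x∈c = on-f (OnEdge-trans M c∈f x∈c)

    rank′ : Fin n → ℕ
    rank′ x = exchange (rank x)

    Step′ : Fin n → Set
    Step′ x = AddMod n (rank′ x) 1 (rank′ (τ′ x))

    step′-e : Step′ e
    step′-e = subst (λ r → AddMod n (exchange r) 1 (rank′ (τ′ e))) (sym rank-base)
                    (exchange-step-0 (step′-on (on-e (inj₁ refl))))

    step′-αe : Step′ (α' M e)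
    step′-αe = exchange-step-j (subst (λ r → AddMod n r 1 (rank (τ′ (α' M e)))) rank-base (step′-α (on-e (inj₂ refl))))

    -- The decisions are passed as arguments: a `with` on x ≟ᶠ e would also abstract it inside τ′ x.
    rank′-step : ∀ x → Step′ x
    rank′-step x = by-cases (x ≟ᶠ e) (x ≟ᶠ α' M e) (x ≟ᶠ c) (x ≟ᶠ c′)
      where
      by-cases : Dec (x ≡ e) → Dec (x ≡ α' M e) → Dec (x ≡ c) → Dec (x ≡ c′) → Step′ x
      by-cases (yes x≡e) _          _         _          = subst Step′ (sym x≡e) step′-e
      by-cases (no _)    (yes x≡αe) _         _          = subst Step′ (sym x≡αe) step′-αe
      by-cases (no _)    (no _)     (yes x≡c) _          =
        subst Step′ (sym x≡c) (exchange-step-i (step′-on (on-c (inj₁ refl))))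
      by-cases (no _)    (no _)     (no _)    (yes x≡c′) =
        subst Step′ (sym x≡c′) (exchange-step-k (step′-α (on-c (inj₂ refl))))
      by-cases (no x≢e)  (no x≢αe)  (no x≢c)  (no x≢c′)  =
        exchange-step (rank<n x) (x≢e ∘ rank≡0⇒e)
                      (x≢c ∘ rank-injective) (x≢αe ∘ rank-injective) (x≢c′ ∘ rank-injective)
                      (step′-off x≢e x≢αe (off-f x≢c x≢c′ ∘ inj₁) (off-f x≢c x≢c′ ∘ inj₂))

    ranking′ : Ranking τ′
    ranking′ = record
      { rank           = rank′
      ; rank<n         = exchange<N ∘ rank<n
      ; rank-injective = rank-injective ∘ exchange-injective
      ; rank-step      = rank′-step
      }

    quasiTree′ : IsQuasiTree M S′
    quasiTree′ = symDiff-isEdgeSet M edgeSet e f , Ranked.single-cycle M ranking′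

    module New = RankedCross M ranking′

    seg : Fin n → ℕ
    seg x = segment (rank x)

    crossᵇ-new : ∀ x y → distinctEdgesᵇ M x y ≡ true →
                 New.crossᵇ x y ≡ Old.crossᵇ x y xor crossFlip (seg x) (seg (α' M x)) (seg y) (seg (α' M y))
    crossᵇ-new x y dxy = begin
      New.crossᵇ x y
        ≡⟨ New.crossᵇ-distinct x y dxy ⟩
      cyclic (rank′ x) (rank′ y) (rank′ αx) xor cyclic (rank′ x) (rank′ αy) (rank′ αx)
        ≡⟨ cong₂ _xor_ (cyclic-exchange (rank x) (rank y) (rank αx)) (cyclic-exchange (rank x) (rank αy) (rank αx)) ⟩
      (cyclic₁ xor cyclicFlip (seg x) (seg y) (seg αx)) xor (cyclic₂ xor cyclicFlip (seg x) (seg αy) (seg αx))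
        ≡⟨ interchange cyclic₁ (cyclicFlip (seg x) (seg y) (seg αx)) cyclic₂ (cyclicFlip (seg x) (seg αy) (seg αx)) ⟩
      (cyclic₁ xor cyclic₂) xor crossFlip (seg x) (seg αx) (seg y) (seg αy)
        ≡⟨ cong (_xor crossFlip (seg x) (seg αx) (seg y) (seg αy)) (sym (Old.crossᵇ-distinct x y dxy)) ⟩
      Old.crossᵇ x y xor crossFlip (seg x) (seg αx) (seg y) (seg αy) ∎
      where
      open ≡-Reasoning
      αx = α' M x
      αy = α' M y
      cyclic₁ = cyclic (rank x) (rank y) (rank αx)
      cyclic₂ = cyclic (rank x) (rank αy) (rank αx)

    seg-e : seg e ≡ 0
    seg-e = cong segment rank-base

    seg-αe : seg (α' M e) ≡ 2
    seg-αe = segment-index (second i<j ≤-refl)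

    seg-c : seg c ≡ 1
    seg-c = segment-index (first 0<i ≤-refl)

    seg-c′ : seg c′ ≡ 3
    seg-c′ = segment-index (third j<k ≤-refl)

    seg≡0⇒e : ∀ {x} → seg x ≡ 0 → x ≡ e
    seg≡0⇒e {x} seg≡0 = rank≡0⇒e (segment-zero (subst (Segment (rank x)) seg≡0 (segment-of (rank x))))

    ranks-of-f : (rank f ≡ i × rank (α' M f) ≡ k) ⊎ (rank f ≡ k × rank (α' M f) ≡ i)
    ranks-of-f = ranks c∈f
      where
      ranks : OnEdge M f c → (rank f ≡ i × rank (α' M f) ≡ k) ⊎ (rank f ≡ k × rank (α' M f) ≡ i)
      ranks (inj₁ c≡f)  = inj₁ (cong rank (sym c≡f) , cong (rank ∘ α' M) (sym c≡f))
      ranks (inj₂ c≡αf) = inj₂ (cong rank (trans (sym (α-invol f)) (cong (α' M) (sym c≡αf))) , cong rank (sym c≡αf))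

    crossᵇ-e-segments : ∀ x → Old.crossᵇ e x ≡ distinctEdgesᵇ M e x ∧ crossesE (seg x) (seg (α' M x))
    crossᵇ-e-segments x = crossᵇ-guarded e x λ distinct@(x≢e , x≢αe) →
      trans (crossᵇ-e distinct)
            (cong₂ _xor_ (<ᵇ-j (segment-of (rank x)) (x≢αe ∘ rank-injective))
                         (<ᵇ-j (segment-of (rank (α' M x))) (x≢e ∘ α-injective M ∘ rank-injective)))

    around-f : ℕ → Bool
    around-f s = (s <ᵇ 2) xor (s <ᵇ 4)

    -- up to a constant g, the cyclic order around f only depends on the segment
    cyclic-around-f : ∃ λ g → ∀ {r s} → Segment r s → r ≢ i → r ≢ k →
                      cyclic (rank f) r (rank (α' M f)) ≡ around-f s xor g
    cyclic-around-f with ranks-of-f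
    ... | inj₁ (f↦i , αf↦k) = false , λ {r} seg r≢i r≢k →
      trans (cong₂ (λ a b → cyclic a r b) f↦i αf↦k)
            (cyclic-by i r k (<ᵇ-i seg r≢i) (<ᵇ-k seg r≢k) (<ᵇ-false (<⇒≤ (<-trans i<j j<k))))
    ... | inj₂ (f↦k , αf↦i) = true , λ {r} {s} seg r≢i r≢k →
      trans (cong₂ (λ a b → cyclic a r b) f↦k αf↦i)
            (trans (cyclic-by k r i (<ᵇ-k seg r≢k) (<ᵇ-i seg r≢i) (<ᵇ-true (<-trans i<j j<k)))
                   (cong (_xor true) (xor-comm (s <ᵇ 4) (s <ᵇ 2))))

    crossᵇ-f-segments : ∀ x → Old.crossᵇ f x ≡ distinctEdgesᵇ M f x ∧ crossesF (seg x) (seg (α' M x))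
    crossᵇ-f-segments x = crossᵇ-guarded f x λ (x≢f , x≢αf) →
      let (g , around) = cyclic-around-f
          off-c : ∀ {y} → ¬ OnEdge M f y → rank y ≢ i × rank y ≢ k
          off-c {y} y∉f = (λ r≡i → y∉f (subst (OnEdge M f) (sym (rank-injective r≡i)) c∈f))
                        , (λ r≡k → y∉f (subst (OnEdge M f) (sym (rank-injective r≡k)) (OnEdge-trans M c∈f (inj₂ refl))))
          (x≢i , x≢k) = off-c [ x≢f , x≢αf ]
          (αx≢i , αx≢k) = off-c [ (λ αx≡f → x≢αf (trans (sym (α-invol x)) (cong (α' M) αx≡f)))
                                , (λ αx≡αf → x≢f (α-injective M αx≡αf)) ]
      in trans (Old.crossᵇ-distinct f x (distinct-true (x≢f , x≢αf)))
               (trans (cong₂ _xor_ (around (segment-of (rank x)) x≢i x≢k)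
                                   (around (segment-of (rank (α' M x))) αx≢i αx≢k))
                      (xor-cancel-common (around-f (seg x)) (around-f (seg (α' M x))) g))

    e-off-f : DistinctEdges M f e
    e-off-f = (λ e≡f → proj₁ e-f-distinct (sym e≡f))
            , (λ e≡αf → proj₂ e-f-distinct (trans (sym (α-invol f)) (cong (α' M) (sym e≡αf))))

    αe-off-f : DistinctEdges M f (α' M e)
    αe-off-f = (λ αe≡f → proj₂ e-f-distinct (sym αe≡f))
             , (λ αe≡αf → proj₁ e-f-distinct (sym (α-injective M αe≡αf)))

    c-off-e : DistinctEdges M e c
    c-off-e = (λ c≡e → <-irrefl (sym (trans (cong rank c≡e) rank-base)) 0<i) , (λ c≡αe → <-irrefl (cong rank c≡αe) i<j)

    c′-off-e : DistinctEdges M e c′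
    c′-off-e = (λ c′≡e → <-irrefl (sym (trans (cong rank c′≡e) rank-base)) (<-trans 0<i (<-trans i<j j<k)))
             , (λ c′≡αe → <-irrefl (sym (cong rank c′≡αe)) j<k)

    Admissible : Fin n → Set
    Admissible x = admissible (distinctEdgesᵇ M e x) (distinctEdgesᵇ M f x) (seg x) (seg (α' M x)) ≡ true

    admissible-e : Admissible e
    admissible-e rewrite same-edge-false {e} (inj₁ refl) | distinct-true e-off-f | seg-e | seg-αe = refl

    admissible-αe : Admissible (α' M e)
    admissible-αe rewrite same-edge-false {e} (inj₂ refl) | distinct-true αe-off-f | seg-αe
                        | trans (cong seg (α-invol e)) seg-e = refl

    admissible-c : Admissible c
    admissible-c rewrite distinct-true c-off-e | same-edge-false c∈f | seg-c | seg-c′ = refl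

    admissible-c′ : Admissible c′
    admissible-c′ rewrite distinct-true c′-off-e | same-edge-false (OnEdge-trans M c∈f (inj₂ refl)) | seg-c′
                        | trans (cong seg (α-invol c)) seg-c = refl

    admissible-other : ∀ {x} → x ≢ e → x ≢ α' M e → x ≢ c → x ≢ c′ → Admissible x
    admissible-other {x} x≢e x≢αe x≢c x≢c′
      rewrite distinct-true (x≢e , x≢αe) | distinct-true (off-f x≢c x≢c′ ∘ inj₁ , off-f x≢c x≢c′ ∘ inj₂)
            | n≢0⇒n≡ᵇ0≡false (x≢e ∘ seg≡0⇒e)
            | n≢0⇒n≡ᵇ0≡false (λ segαx≡0 → x≢αe (trans (sym (α-invol x)) (cong (α' M) (seg≡0⇒e segαx≡0)))) = refl

    admissible-flag : ∀ x → Admissible x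
    admissible-flag x = by-cases (x ≟ᶠ e) (x ≟ᶠ α' M e) (x ≟ᶠ c) (x ≟ᶠ c′)
      where
      by-cases : Dec (x ≡ e) → Dec (x ≡ α' M e) → Dec (x ≡ c) → Dec (x ≡ c′) → Admissible x
      by-cases (yes x≡e) _          _         _          = subst Admissible (sym x≡e) admissible-e
      by-cases (no _)    (yes x≡αe) _         _          = subst Admissible (sym x≡αe) admissible-αe
      by-cases (no _)    (no _)     (yes x≡c) _          = subst Admissible (sym x≡c) admissible-c
      by-cases (no _)    (no _)     (no _)    (yes x≡c′) = subst Admissible (sym x≡c′) admissible-c′
      by-cases (no x≢e)  (no x≢αe)  (no x≢c)  (no x≢c′)  = admissible-other x≢e x≢αe x≢c x≢c′

    cross-e-f : Old.crossᵇ e f ≡ true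
    cross-e-f = trans (crossᵇ-e e-f-distinct) (separated ranks-of-f)
      where
      separated : (rank f ≡ i × rank (α' M f) ≡ k) ⊎ (rank f ≡ k × rank (α' M f) ≡ i) →
                  ((rank f <ᵇ j) xor (rank (α' M f) <ᵇ j)) ≡ true
      separated (inj₁ (f↦i , αf↦k)) rewrite f↦i | αf↦k | <ᵇ-true i<j | <ᵇ-false (<⇒≤ j<k) = refl
      separated (inj₂ (f↦k , αf↦i)) rewrite f↦k | αf↦i | <ᵇ-true i<j | <ᵇ-false (<⇒≤ j<k) = refl

    cross-e-e : Old.crossᵇ e e ≡ false
    cross-e-e = Old.crossᵇ-same-edge e e (same-edge-false {e} (inj₁ refl))

    cross-f-e : Old.crossᵇ f e ≡ true
    cross-f-e = trans (crossᵇ-f-segments e)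
                (trans (cong₂ (λ d s → d ∧ crossesF s (seg (α' M e))) (distinct-true e-off-f) seg-e) (cong (crossesF 0) seg-αe))

    off-e-somewhere : ∀ {x y} → DistinctEdges M x y → (distinctEdgesᵇ M e x ∨ distinctEdgesᵇ M e y) ≡ true
    off-e-somewhere {x} {y} (y≢x , y≢αx) with distinctEdges? M e x
    ... | yes x-off-e  = cong (_∨ distinctEdgesᵇ M e y) (distinct-true x-off-e)
    ... | no  ¬x-off-e = trans (cong (distinctEdgesᵇ M e x ∨_) (distinct-true y-off-e)) (∨-zeroʳ _)
      where
      x∈e = ¬distinct⇒OnEdge M ¬x-off-e
      y-off-e : DistinctEdges M e y
      y-off-e = (λ y≡e  → [ y≢x , y≢αx ] (OnEdge-trans M (OnEdge-sym M x∈e) (inj₁ y≡e)))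
              , (λ y≡αe → [ y≢x , y≢αx ] (OnEdge-trans M (OnEdge-sym M x∈e) (inj₂ y≡αe)))

    cross-pivot-distinct : ∀ x y → DistinctEdges M x y → New.crossᵇ x y ≡ pivotᵇ M Old.crossᵇ e f x y
    cross-pivot-distinct x y distinct = begin
      New.crossᵇ x y
        ≡⟨ crossᵇ-new x y dxy ⟩
      Old.crossᵇ x y xor crossFlip (seg x) (seg αx) (seg y) (seg αy)
        ≡⟨ pivot-table (bound x) (bound αx) (bound y) (bound αy) dex dfx dey dfy (Old.crossᵇ x y)
                       (admissible-flag x) (admissible-flag y) (off-e-somewhere distinct) ⟩
      pivotOnCrossing (seg x) (seg αx) (seg y) (seg αy) dex dfx dey dfy (Old.crossᵇ x y)
        ≡⟨ sym (pivotᵇ-on-crossing M Old.crossᵇ e f x y cross-e-f cross-e-e cross-f-e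
                                   (crossᵇ-e-segments x) (crossᵇ-f-segments x) (crossᵇ-e-segments y) (crossᵇ-f-segments y)
                                   dxy (distinct-true e-off-f)) ⟩
      pivotᵇ M Old.crossᵇ e f x y ∎
      where
      open ≡-Reasoning
      αx = α' M x
      αy = α' M y
      dex = distinctEdgesᵇ M e x
      dfx = distinctEdgesᵇ M f x
      dey = distinctEdgesᵇ M e y
      dfy = distinctEdgesᵇ M f y
      dxy = distinct-true distinct
      bound : ∀ z → seg z < 5
      bound z = segment<5 (segment-of (rank z))

    cross-pivot : ∀ x y → New.crossᵇ x y ≡ pivotᵇ M Old.crossᵇ e f x y
    cross-pivot x y = by-cases (distinctEdges? M x y)
      where
      by-cases : Dec (DistinctEdges M x y) → New.crossᵇ x y ≡ pivotᵇ M Old.crossᵇ e f x y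
      by-cases (yes distinct) = cross-pivot-distinct x y distinct
      by-cases (no ¬distinct) =
        trans (New.crossᵇ-same-edge x y d≡false)
              (sym (trans (pivotᵇ-same-edge M Old.crossᵇ e f x y d≡false) (Old.crossᵇ-same-edge x y d≡false)))
        where d≡false = reflects-false (distinctEdges-reflects M x y) ¬distinct

    pivot-isomorphism : Λ̃ M S′ ≅ switchColours M (pivot M (Λ̃ M S) e f) e f
    pivot-isomorphism =
      (λ x y → reflects-⇔ (New.cross-reflects x y)
                          (subst (Reflects _) (sym (cross-pivot x y))
                                 (pivot-reflects M (Λ̃ M S) Old.crossᵇ Old.cross-reflects e f x y)))
      , λ _ → refl

    result : PivotResult
    result = quasiTree′ , pivot-isomorphism

  forward : Cross M (tour M S) e f → PivotResult
  forward cross = by-cases (rank f <? j) (rank (α' M f) <? j)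
    where
    by-cases : Dec (rank f < j) → Dec (rank (α' M f) < j) → PivotResult
    by-cases (yes f<j) (no αf≮j) = Crossing.result f (inj₁ refl) (off-e (proj₁ e-f-distinct)) f<j (after-αe αf≮j αf≢αe)
    by-cases (no f≮j) (yes αf<j) = Crossing.result (α' M f) (inj₂ refl) (off-e αf≢e) αf<j
      (subst (λ y → j < rank y) (sym (α-invol f)) (after-αe f≮j f≢αe))
    by-cases (yes f<j) (yes αf<j) = contradiction cross
      (reflects-refute separated-reflects (cong₂ _xor_ (<ᵇ-true f<j) (<ᵇ-true αf<j)))
    by-cases (no f≮j) (no αf≮j) = contradiction cross
      (reflects-refute separated-reflects (cong₂ _xor_ (<ᵇ-false (≮⇒≥ f≮j)) (<ᵇ-false (≮⇒≥ αf≮j))))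

lemma8 : {n : ℕ} (M : Map n) (S : Fin n → Bool) (e f : Fin n) →
    IsQuasiTree M S → DistinctEdges M e f →
    ((CGraph.adj (Λ̃ M S) e f →
        IsQuasiTree M (symDiff M S e f)
        × (Λ̃ M (symDiff M S e f) ≅ switchColours M (pivot M (Λ̃ M S) e f) e f))
    × (IsQuasiTree M (symDiff M S e f) → CGraph.adj (Λ̃ M S) e f))
lemma8 M S e f quasiTree distinct = forward , converse
  where open PivotOnQuasiTree M S quasiTree e f distinct
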